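{- Let $q=2^r$ and let $\psi$ be any nontrivial additive character of $\mathbb{F}_q$. Then $$\sum_{w\in SO^+(2,q)}\psi(\mathrm{Tr}\,w)=K(\psi;1),\qquad \sum_{w\in O^+(2,q)}\psi(\mathrm{Tr}\,w)=K(\psi;1)+q-1,$$ $$\sum_{w\in SO^+(4,q)}\psi(\mathrm{Tr}\,w)=q^2\big(K(\psi;1)^2+q^3-q\big).$$
   Context: $K(\psi;a)=\sum_{\alpha\in\mathbb{F}_q^*}\psi(\alpha+a\alpha^{ -1})$ for $a\in\mathbb{F}_q^*$. $\mathrm{Tr}$ is the matrix trace. On column vectors $x\in\mathbb{F}_q^{2n}$ let $\theta^+(x)=\sum_{i=1}^n x_ix_{n+i}$; $O^+(2n,q)$ is the group of $g\in GL(2n,q)$ preserving $\theta^+$; equivalently, writing $g=\begin{bmatrix}A&B\\C&D\end{bmatrix}$ with $n\times n$ blocks, ${}^tAC,{}^tBD$ are alternating (symmetric with zero diagonal) and ${}^tAD+{}^tCB=1_n$. The map $\delta^+(g)=\mathrm{Tr}(B\,{}^tC)$ is a surjective homomorphism $O^+(2n,q)\to\mathbb{F}_2$ and $SO^+(2n,q)=\ker\delta^+$. -}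

module Defs where

open import Level using (0ℓ; Lift; _⊔_)
open import Data.Unit using (⊤)
import Data.Nat as ℕ
import Data.Fin as Fin
open import Algebra.Bundles using (CommutativeRing)
open import Data.Nat using (ℕ; _^_)
open import Data.Fin using (Fin; _↑ˡ_; _↑ʳ_)
open import Data.Integer using (ℤ; 0ℤ; 1ℤ) renaming (_+_ to _+ℤ_; _*_ to _*ℤ_)
open import Data.List using (List; length; foldr; map)
open import Data.List.Relation.Unary.All using (All)
open import Data.Product using (Σ; ∃; _×_)
open import Relation.Nullary using (¬_; yes; no)
open import Relation.Binary using (Setoid; Decidable)
open import Relation.Binary.PropositionalEquality using (_≡_)
import Data.List.Membership.Setoid as SetoidMembership
import Data.List.Relation.Unary.Unique.Setoid as SetoidUnique

-- Enumerating a subset of a setoid: a duplicate-free list (up to ≈)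
-- containing exactly the elements satisfying P.  A sum "over the set
-- {x | P x}" is the sum over any such list.

record Enumerates {a ℓ p} (S : Setoid a ℓ) (P : Setoid.Carrier S → Set p)
                  (L : List (Setoid.Carrier S)) : Set (a ⊔ ℓ ⊔ p) where
  open SetoidMembership S using (_∈_)
  field
    sound    : All P L
    complete : ∀ x → P x → x ∈ L
    unique   : SetoidUnique.Unique S L

record FiniteField : Set₁ where
  field
    commRing : CommutativeRing 0ℓ 0ℓ
  open CommutativeRing commRing public
  field
    _≟_      : Decidable _≈_
    0≉1      : ¬ (0# ≈ 1#)
    _⁻¹      : Carrier → Carrier
    inverseʳ : ∀ x → ¬ (x ≈ 0#) → x * (x ⁻¹) ≈ 1#
    elements : List Carrier
    enum     : Enumerates setoid (λ _ → Lift 0ℓ ⊤) elements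

order : FiniteField → ℕ
order F = length (FiniteField.elements F)

sumℤ : List ℤ → ℤ
sumℤ = foldr _+ℤ_ 0ℤ

-- In characteristic 2 every additive character
-- of F_q takes values in {±1} ⊂ ℂ*, so it is modelled as a group
-- homomorphism (F,+) → (ℤ,·) (its values are then necessarily units ±1).

record AdditiveCharacter (F : FiniteField) : Set where
  open FiniteField F
  field
    ψ      : Carrier → ℤ
    ψ-cong : ∀ {x y} → x ≈ y → ψ x ≡ ψ y
    ψ-0    : ψ 0# ≡ 1ℤ
    ψ-hom  : ∀ x y → ψ (x + y) ≡ ψ x *ℤ ψ y

Nontrivial : {F : FiniteField} → AdditiveCharacter F → Set
Nontrivial {F} χ = ∃ λ x → ¬ (AdditiveCharacter.ψ χ x ≡ 1ℤ)

module _ (F : FiniteField) where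
  open FiniteField F

  Kloosterman : AdditiveCharacter F → Carrier → ℤ
  Kloosterman χ a = sumℤ (map term elements)
    where
    open AdditiveCharacter χ
    term : Carrier → ℤ
    term α with α ≟ 0#
    ... | yes _ = 0ℤ
    ... | no  _ = ψ (α + a * (α ⁻¹))

  Σ[_] : (n : ℕ) → (Fin n → Carrier) → Carrier
  Σ[ ℕ.zero ] f = 0#
  Σ[ ℕ.suc n ] f = f Fin.zero + Σ[ n ] (λ i → f (Fin.suc i))

  Matrix : ℕ → Set
  Matrix m = Fin m → Fin m → Carrier

  MatrixSetoid : ℕ → Setoid 0ℓ 0ℓ
  MatrixSetoid m = record
    { Carrier = Matrix m
    ; _≈_ = λ g h → ∀ i j → g i j ≈ h i j
    ; isEquivalence = record
      { refl  = λ i j → refl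
      ; sym   = λ p i j → sym (p i j)
      ; trans = λ p q i j → trans (p i j) (q i j) } }

  _·_ : ∀ {m} → Matrix m → Matrix m → Matrix m
  _·_ {m} g h i j = Σ[ m ] (λ k → g i k * h k j)

  identity : ∀ {m} → Matrix m
  identity i j with i Fin.≟ j
  ... | yes _ = 1#
  ... | no  _ = 0#

  Tr : ∀ {m} → Matrix m → Carrier
  Tr {m} g = Σ[ m ] (λ i → g i i)

  apply : ∀ {m} → Matrix m → (Fin m → Carrier) → (Fin m → Carrier)
  apply {m} g x i = Σ[ m ] (λ k → g i k * x k)

  θ⁺ : (n : ℕ) → (Fin (n ℕ.+ n) → Carrier) → Carrier
  θ⁺ n x = Σ[ n ] (λ i → x (i ↑ˡ n) * x (n ↑ʳ i))

  Invertible : ∀ {m} → Matrix m → Set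
  Invertible {m} g = ∃ λ h → (∀ i j → (g · h) i j ≈ identity i j)
                           × (∀ i j → (h · g) i j ≈ identity i j)

  InO⁺ : (n : ℕ) → Matrix (n ℕ.+ n) → Set
  InO⁺ n g = Invertible g × (∀ x → θ⁺ n (apply g x) ≈ θ⁺ n x)

  -- δ⁺(g) = Tr(B ᵗC), B the upper-right and C the lower-left n×n block
  δ⁺ : (n : ℕ) → Matrix (n ℕ.+ n) → Carrier
  δ⁺ n g = Σ[ n ] (λ i → Σ[ n ] (λ j → g (i ↑ˡ n) (n ↑ʳ j) * g (n ↑ʳ i) (j ↑ˡ n)))

  InSO⁺ : (n : ℕ) → Matrix (n ℕ.+ n) → Set
  InSO⁺ n g = InO⁺ n g × (δ⁺ n g ≈ 0#)

  traceSum : ∀ {m} → AdditiveCharacter F → List (Matrix m) → ℤ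
  traceSum χ L = sumℤ (map (λ w → AdditiveCharacter.ψ χ (Tr w)) L)

{-# OPTIONS --safe #-}
-- SO⁺(2, q) consists of the matrices diag(a, a⁻¹), and O⁺(2, q) adds the antidiagonal ones
-- [[0, b], [b⁻¹, 0]]; their traces give K(ψ; 1) and q - 1.
--
-- In characteristic 2 the tensor product (g, h) ↦ g ⊗ h is a bijection SL₂(q)² → SO⁺(4, q)
-- with Tr(g ⊗ h) = tr g · tr h.  It is injective since the only scalar in SL₂ is 1, and
-- surjective since the 2 × 2 minors of w ∈ SO⁺(4, q) are, by polynomial consequences of the
-- orthogonality relations, the squares of the entries of the factors, and squaring is
-- bijective.  Summing over the fibres of the trace on SL₂ reduces the sum to character sums
-- over F, and the substitution b = a⁻¹c turns Σ_{a,b≠0} ψ(u(a)u(b)), u(a) = a + a⁻¹, into K(ψ; 1)².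
module Submission where

open import Defs

open import Level using (0ℓ)
open import Data.Bool using (Bool; true; false)
open import Data.Maybe using (Maybe; just; nothing)
open import Data.Empty using (⊥-elim)
open import Data.Fin using (Fin; _↑ˡ_; _↑ʳ_)
import Data.Fin as Fin
open import Data.Fin.Patterns using (0F; 1F; 2F; 3F)
import Data.Fin.Properties as Finₚ
open import Data.Nat using (ℕ; suc; zero; _^_; z≤n; s≤s) renaming (_≤_ to _≤ℕ_)
import Data.Nat as ℕ
import Data.Nat.Properties as ℕ
open import Data.Integer using (ℤ; 0ℤ; 1ℤ; +_; -[1+_]) renaming (_+_ to _+ℤ_; _-_ to _-ℤ_; _*_ to _*ℤ_)
import Data.Integer as ℤ
import Data.Integer.Properties as ℤ
open import Data.Integer.Tactic.RingSolver using (solve-∀)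
open import Data.List using (List; []; _∷_; map; _++_; length; filter; cartesianProductWith)
open import Data.List.Relation.Unary.Any using (here; there)
import Data.List.Relation.Unary.Any as Any
import Data.List.Relation.Unary.Any.Properties as AnyP
import Data.List.Relation.Unary.All.Properties as AllP
open import Data.List.Relation.Unary.All.Properties using (All¬⇒¬Any)
import Data.List.Properties
open import Data.Vec using (Vec)
import Data.Vec as Vec
import Data.Vec.Properties as Vecₚ
open import Data.List.Relation.Unary.All using (All; []; _∷_)
import Data.List.Relation.Unary.All as All
open import Data.List.Relation.Unary.AllPairs using ([]; _∷_)
open import Data.Product using (Σ; ∃; _×_; _,_; proj₁; proj₂; uncurry)
open import Data.Sum using (_⊎_; inj₁; inj₂)
open import Algebra.Bundles using (CommutativeRing; Semiring)
open import Algebra.Bundles.Raw using (RawSemiring)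
open import Relation.Binary using (Setoid)
open import Function using (_∘_)
open import Relation.Binary.PropositionalEquality as ≡ using (_≡_)
open import Relation.Nullary using (Dec; yes; no; ¬_)
open import Relation.Nullary.Decidable using (¬?)
open import Relation.Unary using (Pred; Decidable)
import Data.List.Membership.Setoid as Membership
import Data.List.Membership.Setoid.Properties as Membershipₚ
import Data.List.Relation.Binary.Subset.Setoid as Subset
import Data.List.Relation.Unary.Unique.Setoid as UniqueS
import Data.List.Relation.Unary.Unique.Setoid.Properties as Uniqueₚ

module ListSum where

  sumMap : {A : Set} → (A → ℤ) → List A → ℤ
  sumMap f xs = sumℤ (map f xs)

  keepIf : ∀ {p} {P : Set p} → Dec P → ℤ → ℤ
  keepIf (yes _) v = v
  keepIf (no _)  _ = 0ℤ

  dropIf : ∀ {p} {P : Set p} → Dec P → ℤ → ℤ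
  dropIf (yes _) _ = 0ℤ
  dropIf (no _)  v = v

  keepIf+dropIf : ∀ {p} {P : Set p} (d : Dec P) v → keepIf d v +ℤ dropIf d v ≡ v
  keepIf+dropIf (yes _) v = ℤ.+-identityʳ v
  keepIf+dropIf (no _)  v = ℤ.+-identityˡ v

  keepIf-cong : ∀ {a b} {P : Set a} {Q : Set b} (P? : Dec P) (Q? : Dec Q) → (P → Q) → (Q → P) →
    ∀ v → keepIf P? v ≡ keepIf Q? v
  keepIf-cong (yes _) (yes _) _   _   v = ≡.refl
  keepIf-cong (no _)  (no _)  _   _   v = ≡.refl
  keepIf-cong (yes p) (no ¬q) p⇒q _   v = ⊥-elim (¬q (p⇒q p))
  keepIf-cong (no ¬p) (yes q) _   q⇒p v = ⊥-elim (¬p (q⇒p q))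

  keepIf-*ˡ : ∀ {a} {P : Set a} (P? : Dec P) c v → c *ℤ keepIf P? v ≡ keepIf P? (c *ℤ v)
  keepIf-*ˡ (yes _) c v = ≡.refl
  keepIf-*ˡ (no _)  c v = ℤ.*-zeroʳ c

  private variable A B C : Set

  sumMap-cong : ∀ {f g : A → ℤ} → (∀ x → f x ≡ g x) → ∀ xs → sumMap f xs ≡ sumMap g xs
  sumMap-cong e []       = ≡.refl
  sumMap-cong e (x ∷ xs) = ≡.cong₂ _+ℤ_ (e x) (sumMap-cong e xs)

  sumMap-++ : ∀ (f : A → ℤ) xs ys → sumMap f (xs ++ ys) ≡ sumMap f xs +ℤ sumMap f ys
  sumMap-++ f []       ys = ≡.sym (ℤ.+-identityˡ _)
  sumMap-++ f (x ∷ xs) ys =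
    ≡.trans (≡.cong (f x +ℤ_) (sumMap-++ f xs ys)) (≡.sym (ℤ.+-assoc (f x) _ _))

  sumMap-map : ∀ (f : B → ℤ) (g : A → B) xs → sumMap f (map g xs) ≡ sumMap (λ x → f (g x)) xs
  sumMap-map f g []       = ≡.refl
  sumMap-map f g (x ∷ xs) = ≡.cong (f (g x) +ℤ_) (sumMap-map f g xs)

  sumMap-+ : ∀ (f g : A → ℤ) xs → sumMap (λ x → f x +ℤ g x) xs ≡ sumMap f xs +ℤ sumMap g xs
  sumMap-+ f g []       = ≡.refl
  sumMap-+ f g (x ∷ xs) = ≡.trans (≡.cong (f x +ℤ g x +ℤ_) (sumMap-+ f g xs)) (interchange (f x) (g x) _ _)
    where
    interchange : ∀ a b c d → (a +ℤ b) +ℤ (c +ℤ d) ≡ (a +ℤ c) +ℤ (b +ℤ d)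
    interchange = solve-∀

  sumMap-*ˡ : ∀ c (f : A → ℤ) xs → sumMap (λ x → c *ℤ f x) xs ≡ c *ℤ sumMap f xs
  sumMap-*ˡ c f []       = ≡.sym (ℤ.*-zeroʳ c)
  sumMap-*ˡ c f (x ∷ xs) =
    ≡.trans (≡.cong (c *ℤ f x +ℤ_) (sumMap-*ˡ c f xs)) (≡.sym (ℤ.*-distribˡ-+ c (f x) _))

  sumMap-const : ∀ c (xs : List A) → sumMap (λ _ → c) xs ≡ + length xs *ℤ c
  sumMap-const c []       = ≡.sym (ℤ.*-zeroˡ c)
  sumMap-const c (x ∷ xs) = ≡.trans (≡.cong (c +ℤ_) (sumMap-const c xs)) (lemma c (+ length xs))
    where
    lemma : ∀ c n → c +ℤ n *ℤ c ≡ (1ℤ +ℤ n) *ℤ c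
    lemma = solve-∀

  sumMap-zero : ∀ {f : A → ℤ} → (∀ x → f x ≡ 0ℤ) → ∀ xs → sumMap f xs ≡ 0ℤ
  sumMap-zero e xs =
    ≡.trans (sumMap-cong e xs) (≡.trans (sumMap-const 0ℤ xs) (ℤ.*-zeroʳ (+ length xs)))

  sumMap-swap : ∀ (f : A → B → ℤ) xs ys →
    sumMap (λ x → sumMap (f x) ys) xs ≡ sumMap (λ y → sumMap (λ x → f x y) xs) ys
  sumMap-swap f []       ys = ≡.sym (sumMap-zero (λ _ → ≡.refl) ys)
  sumMap-swap f (x ∷ xs) ys =
    ≡.trans (≡.cong (sumMap (f x) ys +ℤ_) (sumMap-swap f xs ys)) (≡.sym (sumMap-+ (f x) _ ys))

  sumMap-cartesianProductWith : ∀ (f : C → ℤ) (g : A → B → C) xs ys →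
    sumMap f (cartesianProductWith g xs ys) ≡ sumMap (λ x → sumMap (λ y → f (g x y)) ys) xs
  sumMap-cartesianProductWith f g []       ys = ≡.refl
  sumMap-cartesianProductWith f g (x ∷ xs) ys = ≡.trans (sumMap-++ f (map (g x) ys) _)
    (≡.cong₂ _+ℤ_ (sumMap-map f (g x) ys) (sumMap-cartesianProductWith f g xs ys))

  sumMap-filter : ∀ {p} {P : Pred A p} (P? : Decidable P) (f : A → ℤ) xs →
    sumMap f (filter P? xs) ≡ sumMap (λ x → keepIf (P? x) (f x)) xs
  sumMap-filter P? f []       = ≡.refl
  sumMap-filter P? f (x ∷ xs) with P? x
  ... | yes _ = ≡.cong (f x +ℤ_) (sumMap-filter P? f xs)
  ... | no _  = ≡.trans (sumMap-filter P? f xs) (≡.sym (ℤ.+-identityˡ _))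

open ListSum

module UniqueLists (S : Setoid 0ℓ 0ℓ) where
  open Setoid S renaming (Carrier to A)
  open Membership S using (_∈_)
  open Subset S using (_⊆_)
  open UniqueS S using (Unique)

  ∉-All≉ : ∀ {x z ys} → All (x ≉_) ys → z ∈ ys → z ≉ x
  ∉-All≉ (x≉y ∷ _)  (here z≈y) z≈x = x≉y (trans (sym z≈x) z≈y)
  ∉-All≉ (_ ∷ x≉ys) (there p)  z≈x = ∉-All≉ x≉ys p z≈x

  private
    remove : ∀ {x} ys → x ∈ ys → List A
    remove (y ∷ ys) (here _)  = ys
    remove (y ∷ ys) (there p) = y ∷ remove ys p

    length-remove : ∀ {x} ys (p : x ∈ ys) → suc (length (remove ys p)) ≡ length ys
    length-remove (y ∷ ys) (here _)  = ≡.refl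
    length-remove (y ∷ ys) (there p) = ≡.cong suc (length-remove ys p)

    ∈-remove⁻ : ∀ {x z} ys (p : x ∈ ys) → z ∈ remove ys p → z ∈ ys
    ∈-remove⁻ (y ∷ ys) (here _)  q         = there q
    ∈-remove⁻ (y ∷ ys) (there p) (here e)  = here e
    ∈-remove⁻ (y ∷ ys) (there p) (there q) = there (∈-remove⁻ ys p q)

    ∈-remove⁺ : ∀ {x z} ys (p : x ∈ ys) → z ∈ ys → z ≉ x → z ∈ remove ys p
    ∈-remove⁺ (y ∷ ys) (here e)  (here e′) z≉x = ⊥-elim (z≉x (trans e′ (sym e)))
    ∈-remove⁺ (y ∷ ys) (here e)  (there q) _   = q
    ∈-remove⁺ (y ∷ ys) (there p) (here e′) _   = here e′
    ∈-remove⁺ (y ∷ ys) (there p) (there q) z≉x = there (∈-remove⁺ ys p q z≉x)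

    remove-≉ : ∀ {x z} ys (p : x ∈ ys) → Unique ys → z ∈ remove ys p → z ≉ x
    remove-≉ (y ∷ ys) (here x≈y) (y≉ys ∷ _) q z≈x         = ∉-All≉ y≉ys q (trans z≈x x≈y)
    remove-≉ (y ∷ ys) (there p)  (y≉ys ∷ _) (here z≈y) z≈x = ∉-All≉ y≉ys p (trans (sym z≈x) z≈y)
    remove-≉ (y ∷ ys) (there p)  (_ ∷ u)    (there q)  z≈x = remove-≉ ys p u q z≈x

    All-remove : ∀ {x} {P : A → Set} ys (p : x ∈ ys) → All P ys → All P (remove ys p)
    All-remove (y ∷ ys) (here _)  (_ ∷ a)  = a
    All-remove (y ∷ ys) (there p) (py ∷ a) = py ∷ All-remove ys p a

    Unique-remove : ∀ {x} ys (p : x ∈ ys) → Unique ys → Unique (remove ys p)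
    Unique-remove (y ∷ ys) (here _)  (_ ∷ u)     = u
    Unique-remove (y ∷ ys) (there p) (y≉ys ∷ u) = All-remove ys p y≉ys ∷ Unique-remove ys p u

    ⊆-remove : ∀ {x xs} ys (p : x ∈ ys) → All (x ≉_) xs → xs ⊆ ys → xs ⊆ remove ys p
    ⊆-remove ys p x≉xs xs⊆ys q = ∈-remove⁺ ys p (xs⊆ys q) (∉-All≉ x≉xs q)

  length-mono-⊆ : ∀ {xs ys} → Unique xs → xs ⊆ ys → length xs ≤ℕ length ys
  length-mono-⊆ {[]}     _             _     = z≤n
  length-mono-⊆ {x ∷ xs} {ys} (x≉xs ∷ u) xs⊆ys =
    ≡.subst (suc (length xs) ≤ℕ_) (length-remove ys x∈ys)
      (s≤s (length-mono-⊆ u (⊆-remove ys x∈ys x≉xs (xs⊆ys ∘ there))))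
    where
    x∈ys : x ∈ ys
    x∈ys = xs⊆ys (here refl)

  module _ (f : A → ℤ) (f-cong : ∀ {x y} → x ≈ y → f x ≡ f y) where

    private
      sumMap-remove : ∀ {x} ys (p : x ∈ ys) → sumMap f ys ≡ f x +ℤ sumMap f (remove ys p)
      sumMap-remove (y ∷ ys) (here x≈y) = ≡.cong (_+ℤ sumMap f ys) (f-cong (sym x≈y))
      sumMap-remove {x} (y ∷ ys) (there p) =
        ≡.trans (≡.cong (f y +ℤ_) (sumMap-remove ys p)) (swap-head (f y) (f x) _)
        where
        swap-head : ∀ a b c → a +ℤ (b +ℤ c) ≡ b +ℤ (a +ℤ c)
        swap-head = solve-∀

    sumMap-⊆⊇ : ∀ {xs ys} → Unique xs → Unique ys → xs ⊆ ys → ys ⊆ xs → sumMap f xs ≡ sumMap f ys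
    sumMap-⊆⊇ {[]}     {[]}     _ _ _ _ = ≡.refl
    sumMap-⊆⊇ {[]}     {y ∷ ys} _ _ _ ys⊆[] with ys⊆[] (here refl)
    ... | ()
    sumMap-⊆⊇ {x ∷ xs} {ys} (x≉xs ∷ u) uys xs⊆ys ys⊆xs =
      ≡.trans (≡.cong (f x +ℤ_) rest) (≡.sym (sumMap-remove ys x∈ys))
      where
      x∈ys : x ∈ ys
      x∈ys = xs⊆ys (here refl)
      back : ∀ {z} → z ∈ remove ys x∈ys → z ∈ xs
      back q with ys⊆xs (∈-remove⁻ ys x∈ys q)
      ... | here z≈x = ⊥-elim (remove-≉ ys x∈ys uys q z≈x)
      ... | there r  = r
      rest : sumMap f xs ≡ sumMap f (remove ys x∈ys)
      rest = sumMap-⊆⊇ u (Unique-remove ys x∈ys uys) (⊆-remove ys x∈ys x≉xs (xs⊆ys ∘ there)) back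

    sumMap-Enumerates : ∀ {p} {P : A → Set p} {xs ys} →
      Enumerates S P xs → Enumerates S P ys → sumMap f xs ≡ sumMap f ys
    sumMap-Enumerates exs eys =
      sumMap-⊆⊇ (Enumerates.unique exs) (Enumerates.unique eys) (⊆-enum exs eys) (⊆-enum eys exs)
      where
      ⊆-enum : ∀ {xs ys} → Enumerates S _ xs → Enumerates S _ ys → xs ⊆ ys
      ⊆-enum exs eys x∈xs with All.lookupAny (Enumerates.sound exs) x∈xs
      ... | Py , x≈y = Membershipₚ.∈-resp-≈ S (sym x≈y) (Enumerates.complete eys _ Py)

module UniqueImages (S T U : Setoid 0ℓ 0ℓ) where
  open Setoid S using () renaming (Carrier to A; _≈_ to _≈₁_)
  open Setoid T using () renaming (Carrier to B; _≈_ to _≈₂_; refl to refl₂; sym to sym₂)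
  open Setoid U using () renaming (Carrier to C; _≈_ to _≈₃_; _≉_ to _≉₃_; sym to sym₃; trans to trans₃)
  open Membership S using () renaming (_∈_ to _∈₁_)
  open Membership T using () renaming (_∈_ to _∈₂_)
  open Membership U using () renaming (_∈_ to _∈₃_)

  Unique-map-on : ∀ (g : B → C) {ys} → (∀ {y z} → y ∈₂ ys → z ∈₂ ys → g y ≈₃ g z → y ≈₂ z) →
    UniqueS.Unique T ys → UniqueS.Unique U (map g ys)
  Unique-map-on g {[]}     inj []           = []
  Unique-map-on g {y ∷ ys} inj (y≉ys ∷ u) =
    AllP.map⁺ (All.tabulateₛ T (λ z∈ys gy≈gz →
      UniqueLists.∉-All≉ T y≉ys z∈ys (sym₂ (inj (here refl₂) (there z∈ys) gy≈gz))))
    ∷ Unique-map-on g (λ p q → inj (there p) (there q)) u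

  Unique-cartesianProductWith-on : ∀ (f : A → B → C) {xs ys} →
    (∀ {w x y z} → w ∈₁ xs → x ∈₁ xs → y ∈₂ ys → z ∈₂ ys →
       f w y ≈₃ f x z → w ≈₁ x × y ≈₂ z) →
    UniqueS.Unique S xs → UniqueS.Unique T ys → UniqueS.Unique U (cartesianProductWith f xs ys)
  Unique-cartesianProductWith-on f {[]}     inj _            _  = []
  Unique-cartesianProductWith-on f {x ∷ xs} {ys} inj (x≉xs ∷ u) uys = Uniqueₚ.++⁺ U
    (Unique-map-on (f x) (λ y∈ z∈ e → proj₂ (inj (here (Setoid.refl S)) (here (Setoid.refl S)) y∈ z∈ e)) uys)
    (Unique-cartesianProductWith-on f (λ w∈ x∈ → inj (there w∈) (there x∈)) u uys)
    disjoint
    where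
    disjoint : ∀ {v} → ¬ (v ∈₃ map (f x) ys × v ∈₃ cartesianProductWith f xs ys)
    disjoint (v∈map , v∈rest) with Membershipₚ.∈-map⁻ T U v∈map
                                 | Membershipₚ.∈-cartesianProductWith⁻ S T U f xs ys v∈rest
    ... | y , y∈ , v≈fxy | x′ , y′ , x′∈ , y′∈ , v≈fx′y′ =
      UniqueLists.∉-All≉ S x≉xs x′∈ (Setoid.sym S (proj₁ (inj (here (Setoid.refl S)) (there x′∈) y∈ y′∈
        (trans₃ (sym₃ v≈fxy) v≈fx′y′))))

module FieldProperties (F : FiniteField) where
  open FiniteField F
  open import Relation.Binary.Reasoning.Setoid setoid

  inverseˡ : ∀ x → x ≉ 0# → x ⁻¹ * x ≈ 1#
  inverseˡ x x≉0 = trans (*-comm _ _) (inverseʳ x x≉0)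

  *-cancelˡ : ∀ {c x y} → c ≉ 0# → c * x ≈ c * y → x ≈ y
  *-cancelˡ {c} {x} {y} c≉0 e = begin
    x                ≈⟨ *-identityˡ x ⟨
    1# * x           ≈⟨ *-congʳ (inverseˡ c c≉0) ⟨
    (c ⁻¹ * c) * x   ≈⟨ *-assoc _ _ _ ⟩
    c ⁻¹ * (c * x)   ≈⟨ *-congˡ e ⟩
    c ⁻¹ * (c * y)   ≈⟨ *-assoc _ _ _ ⟨
    (c ⁻¹ * c) * y   ≈⟨ *-congʳ (inverseˡ c c≉0) ⟩
    1# * y           ≈⟨ *-identityˡ y ⟩
    y                ∎

  *-cancelʳ : ∀ {c x y} → c ≉ 0# → x * c ≈ y * c → x ≈ y
  *-cancelʳ c≉0 e = *-cancelˡ c≉0 (trans (*-comm _ _) (trans e (*-comm _ _)))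

  zero-product : ∀ {x y} → x * y ≈ 0# → x ≈ 0# ⊎ y ≈ 0#
  zero-product {x} {y} xy≈0 with x ≟ 0#
  ... | yes x≈0 = inj₁ x≈0
  ... | no  x≉0 = inj₂ (*-cancelˡ x≉0 (trans xy≈0 (sym (zeroʳ x))))

  *-≉0 : ∀ {x y} → x ≉ 0# → y ≉ 0# → x * y ≉ 0#
  *-≉0 x≉0 y≉0 xy≈0 with zero-product xy≈0
  ... | inj₁ x≈0 = x≉0 x≈0
  ... | inj₂ y≈0 = y≉0 y≈0

  inverse-unique : ∀ {x y} → x * y ≈ 1# → y ≈ x ⁻¹
  inverse-unique {x} {y} xy≈1 = *-cancelˡ x≉0 (trans xy≈1 (sym (inverseʳ x x≉0)))
    where
    x≉0 : x ≉ 0#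
    x≉0 x≈0 = 0≉1 (trans (sym (trans (*-congʳ x≈0) (zeroˡ y))) xy≈1)

  ⁻¹-≉0 : ∀ {x} → x ≉ 0# → x ⁻¹ ≉ 0#
  ⁻¹-≉0 {x} x≉0 x⁻¹≈0 = 0≉1 (trans (sym (trans (*-congˡ x⁻¹≈0) (zeroʳ x))) (inverseʳ x x≉0))

  -- _⁻¹ is only known to respect _≈_ away from 0 (0 ⁻¹ is an arbitrary junk value).
  ⁻¹-cong : ∀ {x y} → x ≉ 0# → x ≈ y → x ⁻¹ ≈ y ⁻¹
  ⁻¹-cong {x} x≉0 x≈y = inverse-unique (trans (*-congʳ (sym x≈y)) (inverseʳ x x≉0))

  1⁻¹≈1 : 1# ⁻¹ ≈ 1#
  1⁻¹≈1 = sym (inverse-unique (*-identityʳ 1#))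

  ∈-elements : ∀ x → Membership._∈_ setoid x elements
  ∈-elements x = Enumerates.complete enum x _

  -- Pigeonhole: if y were missed, y ∷ map σ elements would be a duplicate-free list
  -- of elements longer than the enumeration itself.
  injective⇒surjective : ∀ (σ : Carrier → Carrier) → (∀ {x y} → σ x ≈ σ y → x ≈ y) →
    ∀ y → ∃ λ x → y ≈ σ x
  injective⇒surjective σ σ-inj y with Any.any? (y ≟_) (map σ elements)
  ... | yes y∈image = let x , _ , y≈σx = Membershipₚ.∈-map⁻ setoid setoid y∈image in x , y≈σx
  ... | no  y∉image = ⊥-elim (ℕ.<-irrefl ≡.refl (≡.subst (_≤ℕ length elements)
          (≡.cong suc (Data.List.Properties.length-map σ elements))
          (UniqueLists.length-mono-⊆ setoid unique-list (λ {z} _ → ∈-elements z))))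
    where
    unique-list : UniqueS.Unique setoid (y ∷ map σ elements)
    unique-list = AllP.¬Any⇒All¬ _ y∉image ∷ Uniqueₚ.map⁺ setoid setoid σ-inj (Enumerates.unique enum)

HasCharacteristic2 : FiniteField → Set
HasCharacteristic2 F = 1# + 1# ≈ 0#
  where open FiniteField F

module Characteristic2 (F : FiniteField) (char2 : HasCharacteristic2 F) where
  open FiniteField F
  open FieldProperties F
  open import Relation.Binary.Reasoning.Setoid setoid
  import Algebra.Solver.Ring as RingSolver
  import Algebra.Solver.Ring.AlmostCommutativeRing as ACR
  import Data.Bool.Properties as Bool

  x+x≈0 : ∀ x → x + x ≈ 0#
  x+x≈0 x = begin
    x + x         ≈⟨ +-cong (*-identityʳ x) (*-identityʳ x) ⟨
    x * 1# + x * 1# ≈⟨ distribˡ x 1# 1# ⟨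
    x * (1# + 1#)  ≈⟨ *-congˡ char2 ⟩
    x * 0#         ≈⟨ zeroʳ x ⟩
    0#             ∎

  x+y≈0⇒x≈y : ∀ {x y} → x + y ≈ 0# → x ≈ y
  x+y≈0⇒x≈y {x} {y} x+y≈0 = begin
    x             ≈⟨ +-identityʳ x ⟨
    x + 0#        ≈⟨ +-congˡ (x+x≈0 y) ⟨
    x + (y + y)   ≈⟨ +-assoc x y y ⟨
    (x + y) + y   ≈⟨ +-congʳ x+y≈0 ⟩
    0# + y        ≈⟨ +-identityˡ y ⟩
    y             ∎

  x≈y⇒x+y≈0 : ∀ {x y} → x ≈ y → x + y ≈ 0#
  x≈y⇒x+y≈0 {x} {y} x≈y = trans (+-congʳ x≈y) (x+x≈0 y)

  -- In characteristic 2 the ring is an algebra over 𝔽₂ = (Bool, xor, ∧), which gives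
  -- a normaliser for identities that only hold modulo 2.
  private
    𝔽₂ : CommutativeRing 0ℓ 0ℓ
    𝔽₂ = Bool.xor-∧-commutativeRing

    ⟦_⟧₂ : Bool → Carrier
    ⟦ true  ⟧₂ = 1#
    ⟦ false ⟧₂ = 0#

    -1≈1 : - 1# ≈ 1#
    -1≈1 = x+y≈0⇒x≈y (-‿inverseˡ 1#)

    𝔽₂-morphism : CommutativeRing.rawRing 𝔽₂ ACR.-Raw-AlmostCommutative⟶ ACR.fromCommutativeRing commRing
    𝔽₂-morphism = record
      { ⟦_⟧    = ⟦_⟧₂
      ; +-homo = +-homo
      ; *-homo = *-homo
      ; -‿homo = -‿homo
      ; 0-homo = refl
      ; 1-homo = refl
      }
      where
      +-homo : ∀ x y → ⟦ CommutativeRing._+_ 𝔽₂ x y ⟧₂ ≈ ⟦ x ⟧₂ + ⟦ y ⟧₂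
      +-homo false false = sym (+-identityʳ 0#)
      +-homo false true  = sym (+-identityˡ 1#)
      +-homo true  false = sym (+-identityʳ 1#)
      +-homo true  true  = sym char2
      *-homo : ∀ x y → ⟦ CommutativeRing._*_ 𝔽₂ x y ⟧₂ ≈ ⟦ x ⟧₂ * ⟦ y ⟧₂
      *-homo false false = sym (zeroʳ 0#)
      *-homo false true  = sym (zeroˡ 1#)
      *-homo true  false = sym (zeroʳ 1#)
      *-homo true  true  = sym (*-identityʳ 1#)
      -‿homo : ∀ x → ⟦ CommutativeRing.-_ 𝔽₂ x ⟧₂ ≈ - ⟦ x ⟧₂
      -‿homo false = sym (trans (sym (+-identityˡ (- 0#))) (-‿inverseʳ 0#))
      -‿homo true  = sym -1≈1

    ⟦⟧₂-≟ : ∀ x y → Maybe (⟦ x ⟧₂ ≈ ⟦ y ⟧₂)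
    ⟦⟧₂-≟ false false = just refl
    ⟦⟧₂-≟ true  true  = just refl
    ⟦⟧₂-≟ _     _     = nothing

  module 𝔽₂-Solver =
    RingSolver (CommutativeRing.rawRing 𝔽₂) (ACR.fromCommutativeRing commRing) 𝔽₂-morphism ⟦⟧₂-≟
  open 𝔽₂-Solver using (solve; _:=_; _:+_; _:*_; con)

  x+y+x≈y : ∀ x y → (x + y) + x ≈ y
  x+y+x≈y x y = begin
    (x + y) + x ≈⟨ solve 2 (λ x y → (x :+ y) :+ x := (x :+ x) :+ y) refl x y ⟩
    (x + x) + y ≈⟨ +-congʳ (x+x≈0 x) ⟩
    0# + y      ≈⟨ +-identityˡ y ⟩
    y           ∎

  square-injective : ∀ {x y} → x * x ≈ y * y → x ≈ y
  square-injective {x} {y} x²≈y² with zero-product sum²≈0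
    where
    sum²≈0 : (x + y) * (x + y) ≈ 0#
    sum²≈0 = begin
      (x + y) * (x + y)            ≈⟨ solve 2 (λ x y → (x :+ y) :* (x :+ y) := x :* x :+ y :* y) refl x y ⟩
      x * x + y * y                ≈⟨ x≈y⇒x+y≈0 x²≈y² ⟩
      0#                           ∎
  ... | inj₁ x+y≈0 = x+y≈0⇒x≈y x+y≈0
  ... | inj₂ x+y≈0 = x+y≈0⇒x≈y x+y≈0

  √ : Carrier → Carrier
  √ y = proj₁ (injective⇒surjective (λ x → x * x) square-injective y)

  √-square : ∀ y → √ y * √ y ≈ y
  √-square y = sym (proj₂ (injective⇒surjective (λ x → x * x) square-injective y))

module FieldSums (F : FiniteField) where
  open FiniteField F
  open FieldProperties F
  open Membership setoid using (_∈_)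
  open UniqueS setoid using (Unique)

  q : ℤ
  q = + order F

  q²-q : ℤ
  q²-q = q *ℤ (q -ℤ 1ℤ)

  ΣF : (Carrier → ℤ) → ℤ
  ΣF f = sumMap f elements

  Σ* : (Carrier → ℤ) → ℤ
  Σ* f = ΣF (λ x → dropIf (x ≟ 0#) (f x))

  Congruent : (Carrier → ℤ) → Set
  Congruent f = ∀ {x y} → x ≈ y → f x ≡ f y

  Congruent* : (Carrier → ℤ) → Set
  Congruent* f = ∀ {x y} → x ≉ 0# → x ≈ y → f x ≡ f y

  private
    ≉0-resp : ∀ {x y} → x ≈ y → x ≉ 0# → y ≉ 0#
    ≉0-resp x≈y x≉0 y≈0 = x≉0 (trans x≈y y≈0)

  nonzeros : List Carrier
  nonzeros = filter (λ x → ¬? (x ≟ 0#)) elements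

  Unique-nonzeros : Unique nonzeros
  Unique-nonzeros = Uniqueₚ.filter⁺ setoid (λ x → ¬? (x ≟ 0#)) (Enumerates.unique enum)

  ∈-nonzeros : ∀ {x} → x ≉ 0# → x ∈ nonzeros
  ∈-nonzeros {x} x≉0 = Membershipₚ.∈-filter⁺ setoid (λ x → ¬? (x ≟ 0#)) ≉0-resp (∈-elements x) x≉0

  All-nonzeros : All (_≉ 0#) nonzeros
  All-nonzeros = AllP.all-filter (λ x → ¬? (x ≟ 0#)) elements

  ∈-nonzeros⇒≉0 : ∀ {x} → x ∈ nonzeros → x ≉ 0#
  ∈-nonzeros⇒≉0 x∈ = proj₂ (Membershipₚ.∈-filter⁻ setoid (λ x → ¬? (x ≟ 0#)) ≉0-resp {xs = elements} x∈)

  ΣF-cong : ∀ {f g} → (∀ x → f x ≡ g x) → ΣF f ≡ ΣF g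
  ΣF-cong e = sumMap-cong e elements

  Σ*-cong : ∀ {f g} → (∀ x → x ≉ 0# → f x ≡ g x) → Σ* f ≡ Σ* g
  Σ*-cong {f} {g} e = ΣF-cong pointwise
    where
    pointwise : ∀ x → dropIf (x ≟ 0#) (f x) ≡ dropIf (x ≟ 0#) (g x)
    pointwise x with x ≟ 0#
    ... | yes _   = ≡.refl
    ... | no x≉0 = e x x≉0

  ΣF-+ : ∀ f g → ΣF (λ x → f x +ℤ g x) ≡ ΣF f +ℤ ΣF g
  ΣF-+ f g = sumMap-+ f g elements

  ΣF-*ˡ : ∀ c f → ΣF (λ x → c *ℤ f x) ≡ c *ℤ ΣF f
  ΣF-*ˡ c f = sumMap-*ˡ c f elements

  ΣF-const : ∀ v → ΣF (λ _ → v) ≡ q *ℤ v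
  ΣF-const v = sumMap-const v elements

  ΣF-swap : ∀ (f : Carrier → Carrier → ℤ) → ΣF (λ x → ΣF (f x)) ≡ ΣF (λ y → ΣF (λ x → f x y))
  ΣF-swap f = sumMap-swap f elements elements

  Σ*-+ : ∀ f g → Σ* (λ x → f x +ℤ g x) ≡ Σ* f +ℤ Σ* g
  Σ*-+ f g = ≡.trans (ΣF-cong pointwise) (ΣF-+ _ _)
    where
    pointwise : ∀ x → dropIf (x ≟ 0#) (f x +ℤ g x) ≡ dropIf (x ≟ 0#) (f x) +ℤ dropIf (x ≟ 0#) (g x)
    pointwise x with x ≟ 0#
    ... | yes _ = ≡.refl
    ... | no _  = ≡.refl

  Σ*-*ˡ : ∀ c f → Σ* (λ x → c *ℤ f x) ≡ c *ℤ Σ* f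
  Σ*-*ˡ c f = ≡.trans (ΣF-cong pointwise) (ΣF-*ˡ c _)
    where
    pointwise : ∀ x → dropIf (x ≟ 0#) (c *ℤ f x) ≡ c *ℤ dropIf (x ≟ 0#) (f x)
    pointwise x with x ≟ 0#
    ... | yes _ = ≡.sym (ℤ.*-zeroʳ c)
    ... | no _  = ≡.refl

  ΣF-linear : ∀ c f d g → ΣF (λ x → c *ℤ f x +ℤ d *ℤ g x) ≡ c *ℤ ΣF f +ℤ d *ℤ ΣF g
  ΣF-linear c f d g = ≡.trans (ΣF-+ _ _) (≡.cong₂ _+ℤ_ (ΣF-*ˡ c f) (ΣF-*ˡ d g))

  Σ*-linear : ∀ c f d g → Σ* (λ x → c *ℤ f x +ℤ d *ℤ g x) ≡ c *ℤ Σ* f +ℤ d *ℤ Σ* g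
  Σ*-linear c f d g = ≡.trans (Σ*-+ _ _) (≡.cong₂ _+ℤ_ (Σ*-*ˡ c f) (Σ*-*ˡ d g))

  private
    dropIf-ΣF : ∀ {p} {P : Set p} (d : Dec P) g → dropIf d (ΣF g) ≡ ΣF (λ y → dropIf d (g y))
    dropIf-ΣF (yes _) g = ≡.sym (sumMap-zero (λ _ → ≡.refl) elements)
    dropIf-ΣF (no _)  g = ≡.refl

    dropIf-comm : ∀ {a b} {A : Set a} {B : Set b} (d : Dec A) (e : Dec B) v →
      dropIf d (dropIf e v) ≡ dropIf e (dropIf d v)
    dropIf-comm (yes _) (yes _) v = ≡.refl
    dropIf-comm (yes _) (no _)  v = ≡.refl
    dropIf-comm (no _)  (yes _) v = ≡.refl
    dropIf-comm (no _)  (no _)  v = ≡.refl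

  ΣF-Σ*-swap : ∀ (f : Carrier → Carrier → ℤ) → ΣF (λ x → Σ* (f x)) ≡ Σ* (λ y → ΣF (λ x → f x y))
  ΣF-Σ*-swap f = ≡.trans (ΣF-swap _) (ΣF-cong (λ y → ≡.sym (dropIf-ΣF (y ≟ 0#) _)))

  Σ*-swap : ∀ (f : Carrier → Carrier → ℤ) → Σ* (λ x → Σ* (f x)) ≡ Σ* (λ y → Σ* (λ x → f x y))
  Σ*-swap f = begin
    Σ* (λ x → Σ* (f x))                                          ≡⟨ ΣF-cong (λ x → dropIf-ΣF (x ≟ 0#) _) ⟩
    ΣF (λ x → ΣF (λ y → dropIf (x ≟ 0#) (dropIf (y ≟ 0#) (f x y)))) ≡⟨ ΣF-cong (λ x → ΣF-cong (λ y →
                                                                      dropIf-comm (x ≟ 0#) (y ≟ 0#) _)) ⟩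
    ΣF (λ x → Σ* (λ y → dropIf (x ≟ 0#) (f x y)))                 ≡⟨ ΣF-Σ*-swap _ ⟩
    Σ* (λ y → ΣF (λ x → dropIf (x ≟ 0#) (f x y)))                 ∎
    where open ≡.≡-Reasoning

  sumMap-nonzeros : ∀ f → sumMap f nonzeros ≡ Σ* f
  sumMap-nonzeros f = ≡.trans (sumMap-filter (λ x → ¬? (x ≟ 0#)) f elements) (ΣF-cong pointwise)
    where
    pointwise : ∀ x → keepIf (¬? (x ≟ 0#)) (f x) ≡ dropIf (x ≟ 0#) (f x)
    pointwise x with x ≟ 0#
    ... | yes _ = ≡.refl
    ... | no _  = ≡.refl

  ΣF-keepIf-≟ : ∀ a {g} → Congruent g → ΣF (λ x → keepIf (x ≟ a) (g x)) ≡ g a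
  ΣF-keepIf-≟ a {g} g-cong = go elements (Enumerates.unique enum) (∈-elements a)
    where
    h : Carrier → ℤ
    h x = keepIf (x ≟ a) (g x)
    vanishes : ∀ {y} ys → All (y ≉_) ys → y ≈ a → sumMap h ys ≡ 0ℤ
    vanishes []       _            _   = ≡.refl
    vanishes (z ∷ zs) (y≉z ∷ y≉zs) y≈a with z ≟ a
    ... | yes z≈a = ⊥-elim (y≉z (trans y≈a (sym z≈a)))
    ... | no _    = ≡.trans (ℤ.+-identityˡ _) (vanishes zs y≉zs y≈a)
    go : ∀ ys → Unique ys → a ∈ ys → sumMap h ys ≡ g a
    go (y ∷ ys) (y≉ys ∷ _) (here a≈y) with y ≟ a
    ... | yes y≈a = ≡.trans (≡.cong₂ _+ℤ_ (g-cong y≈a) (vanishes ys y≉ys y≈a)) (ℤ.+-identityʳ _)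
    ... | no y≉a  = ⊥-elim (y≉a (sym a≈y))
    go (y ∷ ys) (y≉ys ∷ u) (there a∈ys) with y ≟ a
    ... | yes y≈a = ⊥-elim (All¬⇒¬Any y≉ys (Membershipₚ.∈-resp-≈ setoid (sym y≈a) a∈ys))
    ... | no _    = ≡.trans (ℤ.+-identityˡ _) (go ys u a∈ys)

  ΣF-split : ∀ {f} → Congruent f → ΣF f ≡ f 0# +ℤ Σ* f
  ΣF-split {f} f-cong = begin
    ΣF f                                                    ≡⟨ ΣF-cong (λ x → keepIf+dropIf (x ≟ 0#) (f x)) ⟨
    ΣF (λ x → keepIf (x ≟ 0#) (f x) +ℤ dropIf (x ≟ 0#) (f x)) ≡⟨ ΣF-+ _ _ ⟩
    ΣF (λ x → keepIf (x ≟ 0#) (f x)) +ℤ Σ* f                  ≡⟨ ≡.cong (_+ℤ Σ* f) (ΣF-keepIf-≟ 0# f-cong) ⟩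
    f 0# +ℤ Σ* f                                            ∎
    where open ≡.≡-Reasoning

  Σ*-const : ∀ v → Σ* (λ _ → v) ≡ q *ℤ v -ℤ v
  Σ*-const v = ≡.trans (subtract-v (ΣF-split (λ _ → ≡.refl))) (≡.cong (_-ℤ v) (ΣF-const v))
    where
    t≡v+t-v : ∀ v t → t ≡ v +ℤ t -ℤ v
    t≡v+t-v = solve-∀
    subtract-v : ∀ {s t} → s ≡ v +ℤ t → t ≡ s -ℤ v
    subtract-v {t = t} ≡.refl = t≡v+t-v v t

  ΣF-reindex : ∀ (σ : Carrier → Carrier) → (∀ {x y} → x ≈ y → σ x ≈ σ y) →
    (∀ {x y} → σ x ≈ σ y → x ≈ y) → ∀ {f} → Congruent f → ΣF (λ x → f (σ x)) ≡ ΣF f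
  ΣF-reindex σ σ-cong σ-inj {f} f-cong = ≡.trans (≡.sym (sumMap-map f σ elements))
    (UniqueLists.sumMap-⊆⊇ setoid f f-cong
      (Uniqueₚ.map⁺ setoid setoid σ-inj (Enumerates.unique enum)) (Enumerates.unique enum)
      (λ {z} _ → ∈-elements z) ⊇)
    where
    ⊇ : ∀ {z} → z ∈ elements → z ∈ map σ elements
    ⊇ {z} _ = let x , z≈σx = injective⇒surjective σ σ-inj z in
      Membershipₚ.∈-resp-≈ setoid (sym z≈σx) (Membershipₚ.∈-map⁺ setoid setoid σ-cong (∈-elements x))

  Σ*-reindex : ∀ (σ : Carrier → Carrier) → (∀ {x y} → x ≈ y → σ x ≈ σ y) →
    (∀ {x y} → σ x ≈ σ y → x ≈ y) → (∀ {x} → σ x ≈ 0# → x ≈ 0#) → (∀ {x} → x ≈ 0# → σ x ≈ 0#) →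
    ∀ {f} → Congruent* f → Σ* (λ x → f (σ x)) ≡ Σ* f
  Σ*-reindex σ σ-cong σ-inj σ0⇒0 0⇒σ0 {f} f-cong =
    ≡.trans (ΣF-cong zero-test) (ΣF-reindex σ σ-cong σ-inj f̂-cong)
    where
    f̂ : Carrier → ℤ
    f̂ x = dropIf (x ≟ 0#) (f x)
    f̂-cong : Congruent f̂
    f̂-cong {x} {y} x≈y with x ≟ 0# | y ≟ 0#
    ... | yes _   | yes _   = ≡.refl
    ... | no x≉0  | no _    = f-cong x≉0 x≈y
    ... | yes x≈0 | no y≉0  = ⊥-elim (y≉0 (trans (sym x≈y) x≈0))
    ... | no x≉0  | yes y≈0 = ⊥-elim (x≉0 (trans x≈y y≈0))
    zero-test : ∀ x → dropIf (x ≟ 0#) (f (σ x)) ≡ f̂ (σ x)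
    zero-test x with x ≟ 0# | σ x ≟ 0#
    ... | yes _   | yes _    = ≡.refl
    ... | no _    | no _     = ≡.refl
    ... | yes x≈0 | no σx≉0  = ⊥-elim (σx≉0 (0⇒σ0 x≈0))
    ... | no x≉0  | yes σx≈0 = ⊥-elim (x≉0 (σ0⇒0 σx≈0))

module Characters (F : FiniteField) (χ : AdditiveCharacter F) where
  open FiniteField F
  open AdditiveCharacter χ
  open FieldSums F
  open import Algebra.Properties.Group +-group using (∙-cancelˡ)

  ψ²≡1 : ∀ x → ψ x *ℤ ψ x ≡ 1ℤ
  ψ²≡1 x = unit (ψ x) (ψ (- x)) (≡.trans (≡.sym (ψ-hom x (- x))) (≡.trans (ψ-cong (-‿inverseʳ x)) ψ-0))
    where
    unit : ∀ a b → a *ℤ b ≡ 1ℤ → a *ℤ a ≡ 1ℤ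
    unit a b ab≡1
      with ℕ.m*n≡1⇒m≡1 ℤ.∣ a ∣ ℤ.∣ b ∣ (≡.trans (≡.sym (ℤ.abs-* a b)) (≡.cong ℤ.∣_∣ ab≡1))
    unit (+ .1)     b _ | ≡.refl = ≡.refl
    unit -[1+ .0 ] b _ | ≡.refl = ≡.refl

  -- Characters are modelled with values in ℤ, hence in {±1}; if 2 were invertible every
  -- element would be a double s + s, on which ψ takes the value ψ(s)² = 1.
  nontrivial⇒characteristic2 : Nontrivial χ → HasCharacteristic2 F
  nontrivial⇒characteristic2 (a , ψa≢1) with (1# + 1#) ≟ 0#
  ... | yes 2≈0 = 2≈0
  ... | no  2≉0 = ⊥-elim (ψa≢1 (≡.trans (ψ-cong (sym s+s≈a)) (≡.trans (ψ-hom s s) (ψ²≡1 s))))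
    where
    s : Carrier
    s = (1# + 1#) ⁻¹ * a
    s+s≈a : s + s ≈ a
    s+s≈a = begin
      s + s                   ≈⟨ +-cong (*-identityˡ s) (*-identityˡ s) ⟨
      1# * s + 1# * s          ≈⟨ distribʳ s 1# 1# ⟨
      (1# + 1#) * s            ≈⟨ *-assoc _ _ _ ⟨
      ((1# + 1#) * (1# + 1#) ⁻¹) * a ≈⟨ *-congʳ (inverseʳ _ 2≉0) ⟩
      1# * a                   ≈⟨ *-identityˡ a ⟩
      a                        ∎
      where open import Relation.Binary.Reasoning.Setoid setoid

  module _ (nontrivial : Nontrivial χ) where
    open FieldProperties F

    ΣF-ψ : ΣF ψ ≡ 0ℤ
    ΣF-ψ with ΣF ψ ℤ.≟ 0ℤ
    ... | yes Σψ≡0 = Σψ≡0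
    ... | no  Σψ≢0 = ⊥-elim (proj₂ nontrivial (ℤ.*-cancelʳ-≡ _ _ _ {{ℤ.≢-nonZero Σψ≢0}} shift))
      where
      a : Carrier
      a = proj₁ nontrivial
      shift : ψ a *ℤ ΣF ψ ≡ 1ℤ *ℤ ΣF ψ
      shift = begin
        ψ a *ℤ ΣF ψ          ≡⟨ ΣF-*ˡ (ψ a) ψ ⟨
        ΣF (λ x → ψ a *ℤ ψ x) ≡⟨ ΣF-cong (λ x → ψ-hom a x) ⟨
        ΣF (λ x → ψ (a + x))  ≡⟨ ΣF-reindex (λ x → a + x) +-congˡ (λ {x} {y} → ∙-cancelˡ a x y) ψ-cong ⟩
        ΣF ψ                 ≡⟨ ℤ.*-identityˡ _ ⟨
        1ℤ *ℤ ΣF ψ            ∎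
        where open ≡.≡-Reasoning

    ΣF-ψ-* : ∀ s → ΣF (λ t → ψ (s * t)) ≡ keepIf (s ≟ 0#) q
    ΣF-ψ-* s with s ≟ 0#
    ... | yes s≈0 = ≡.trans (ΣF-cong (λ t → ≡.trans (ψ-cong (trans (*-congʳ s≈0) (zeroˡ t))) ψ-0))
                            (≡.trans (ΣF-const 1ℤ) (ℤ.*-identityʳ q))
    ... | no  s≉0 = ≡.trans (ΣF-reindex (s *_) *-congˡ (*-cancelˡ s≉0) ψ-cong) ΣF-ψ

module Matrices (F : FiniteField) where
  open FiniteField F
  open import Relation.Binary.Reasoning.Setoid setoid

  ∑ : ∀ n → (Fin n → Carrier) → Carrier
  ∑ = Σ[_] F

  infixl 7 _·ₘ_
  _·ₘ_ : ∀ {m} → Matrix F m → Matrix F m → Matrix F m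
  _·ₘ_ = _·_ F

  I : ∀ {m} → Matrix F m
  I = identity F

  infix 4 _≈ₘ_
  _≈ₘ_ : ∀ {m} → Matrix F m → Matrix F m → Set
  g ≈ₘ h = ∀ i j → g i j ≈ h i j

  ∑-cong : ∀ n {f g : Fin n → Carrier} → (∀ i → f i ≈ g i) → ∑ n f ≈ ∑ n g
  ∑-cong zero    e = refl
  ∑-cong (suc n) e = +-cong (e Fin.zero) (∑-cong n (e ∘ Fin.suc))

  ∑-zero : ∀ n → ∑ n (λ _ → 0#) ≈ 0#
  ∑-zero zero    = refl
  ∑-zero (suc n) = trans (+-identityˡ _) (∑-zero n)

  ∑-+ : ∀ n (f g : Fin n → Carrier) → ∑ n (λ i → f i + g i) ≈ ∑ n f + ∑ n g
  ∑-+ zero    f g = sym (+-identityʳ 0#)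
  ∑-+ (suc n) f g = trans (+-congˡ (∑-+ n _ _)) (interchange _ _ _ _)
    where
    interchange : ∀ a b c d → (a + b) + (c + d) ≈ (a + c) + (b + d)
    interchange a b c d = begin
      (a + b) + (c + d) ≈⟨ +-assoc a b _ ⟩
      a + (b + (c + d)) ≈⟨ +-congˡ (+-assoc b c d) ⟨
      a + ((b + c) + d) ≈⟨ +-congˡ (+-congʳ (+-comm b c)) ⟩
      a + ((c + b) + d) ≈⟨ +-congˡ (+-assoc c b d) ⟩
      a + (c + (b + d)) ≈⟨ +-assoc a c _ ⟨
      (a + c) + (b + d) ∎

  ∑-*ˡ : ∀ n a (f : Fin n → Carrier) → a * ∑ n f ≈ ∑ n (λ i → a * f i)
  ∑-*ˡ zero    a f = zeroʳ a
  ∑-*ˡ (suc n) a f = trans (distribˡ a _ _) (+-congˡ (∑-*ˡ n a _))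

  ∑-*ʳ : ∀ n a (f : Fin n → Carrier) → ∑ n f * a ≈ ∑ n (λ i → f i * a)
  ∑-*ʳ zero    a f = zeroˡ a
  ∑-*ʳ (suc n) a f = trans (distribʳ a _ _) (+-congˡ (∑-*ʳ n a _))

  ∑-swap : ∀ n m (f : Fin n → Fin m → Carrier) → ∑ n (λ i → ∑ m (f i)) ≈ ∑ m (λ j → ∑ n (λ i → f i j))
  ∑-swap zero    m f = sym (∑-zero m)
  ∑-swap (suc n) m f = trans (+-congˡ (∑-swap n m _)) (sym (∑-+ m _ _))

  identity-suc : ∀ {n} (i j : Fin n) → I (Fin.suc i) (Fin.suc j) ≈ I i j
  identity-suc i j with i Fin.≟ j | Fin.suc i Fin.≟ Fin.suc j
  ... | yes _   | yes _     = refl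
  ... | no _    | no _      = refl
  ... | yes i≡j | no si≢sj  = ⊥-elim (si≢sj (≡.cong Fin.suc i≡j))
  ... | no i≢j  | yes si≡sj = ⊥-elim (i≢j (Finₚ.suc-injective si≡sj))

  ∑-identityʳ : ∀ n (f : Fin n → Carrier) j → ∑ n (λ k → f k * I k j) ≈ f j
  ∑-identityʳ (suc n) f Fin.zero = begin
    f Fin.zero * 1# + ∑ n (λ k → f (Fin.suc k) * 0#) ≈⟨ +-cong (*-identityʳ _) (∑-cong n (λ k → zeroʳ _)) ⟩
    f Fin.zero + ∑ n (λ _ → 0#)                      ≈⟨ +-congˡ (∑-zero n) ⟩
    f Fin.zero + 0#                                 ≈⟨ +-identityʳ _ ⟩
    f Fin.zero                                      ∎
  ∑-identityʳ (suc n) f (Fin.suc j) = begin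
    f Fin.zero * 0# + ∑ n (λ k → f (Fin.suc k) * I (Fin.suc k) (Fin.suc j))
      ≈⟨ +-cong (zeroʳ _) (∑-cong n (λ k → *-congˡ (identity-suc k j))) ⟩
    0# + ∑ n (λ k → f (Fin.suc k) * I k j)          ≈⟨ +-identityˡ _ ⟩
    ∑ n (λ k → f (Fin.suc k) * I k j)               ≈⟨ ∑-identityʳ n (f ∘ Fin.suc) j ⟩
    f (Fin.suc j)                                   ∎

  ∑-identityˡ : ∀ n (f : Fin n → Carrier) i → ∑ n (λ k → I i k * f k) ≈ f i
  ∑-identityˡ n f i = trans (∑-cong n (λ k → trans (*-comm _ _) (*-congˡ (I-sym i k)))) (∑-identityʳ n f i)
    where
    I-sym : ∀ {n} (i j : Fin n) → I i j ≈ I j i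
    I-sym Fin.zero    Fin.zero    = refl
    I-sym Fin.zero    (Fin.suc j) = refl
    I-sym (Fin.suc i) Fin.zero    = refl
    I-sym (Fin.suc i) (Fin.suc j) = trans (identity-suc i j) (trans (I-sym i j) (sym (identity-suc j i)))

  mat₂ : Carrier → Carrier → Carrier → Carrier → Matrix F 2
  mat₂ a b c d 0F 0F = a
  mat₂ a b c d 0F 1F = b
  mat₂ a b c d 1F 0F = c
  mat₂ a b c d 1F 1F = d

  mat₂-≈ : ∀ {g h : Matrix F 2} → g 0F 0F ≈ h 0F 0F → g 0F 1F ≈ h 0F 1F → g 1F 0F ≈ h 1F 0F →
    g 1F 1F ≈ h 1F 1F → g ≈ₘ h
  mat₂-≈ e₀₀ e₀₁ e₁₀ e₁₁ 0F 0F = e₀₀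
  mat₂-≈ e₀₀ e₀₁ e₁₀ e₁₁ 0F 1F = e₀₁
  mat₂-≈ e₀₀ e₀₁ e₁₀ e₁₁ 1F 0F = e₁₀
  mat₂-≈ e₀₀ e₀₁ e₁₀ e₁₁ 1F 1F = e₁₁

  Tr-cong : ∀ {m} {g h : Matrix F m} → g ≈ₘ h → Tr F g ≈ Tr F h
  Tr-cong {m} g≈h = ∑-cong m (λ i → g≈h i i)

  ·-cong : ∀ {m} {g g′ h h′ : Matrix F m} → g ≈ₘ g′ → h ≈ₘ h′ → g ·ₘ h ≈ₘ g′ ·ₘ h′
  ·-cong {m} g≈g′ h≈h′ i j = ∑-cong m (λ k → *-cong (g≈g′ i k) (h≈h′ k j))

  ·-assoc : ∀ {m} (g h k : Matrix F m) → (g ·ₘ h) ·ₘ k ≈ₘ g ·ₘ (h ·ₘ k)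
  ·-assoc {m} g h k i j = begin
    ∑ m (λ l → ∑ m (λ r → g i r * h r l) * k l j)   ≈⟨ ∑-cong m (λ l → ∑-*ʳ m _ _) ⟩
    ∑ m (λ l → ∑ m (λ r → (g i r * h r l) * k l j)) ≈⟨ ∑-swap m m _ ⟩
    ∑ m (λ r → ∑ m (λ l → (g i r * h r l) * k l j)) ≈⟨ ∑-cong m (λ r → ∑-cong m (λ l → *-assoc _ _ _)) ⟩
    ∑ m (λ r → ∑ m (λ l → g i r * (h r l * k l j))) ≈⟨ ∑-cong m (λ r → ∑-*ˡ m _ _) ⟨
    ∑ m (λ r → g i r * ∑ m (λ l → h r l * k l j))   ∎

  ·-identityˡ : ∀ {m} (g : Matrix F m) → I ·ₘ g ≈ₘ g
  ·-identityˡ {m} g i j = ∑-identityˡ m (λ k → g k j) i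

  ·-identityʳ : ∀ {m} (g : Matrix F m) → g ·ₘ I ≈ₘ g
  ·-identityʳ {m} g i j = ∑-identityʳ m (g i) j

  left-inverse⇒right-inverse : ∀ {m} {g h : Matrix F m} → Invertible F g → h ·ₘ g ≈ₘ I → g ·ₘ h ≈ₘ I
  left-inverse⇒right-inverse {m} {g} {h} (g⁻¹ , g·g⁻¹≈I , _) h·g≈I i j = begin
    (g ·ₘ h) i j     ≈⟨ ·-cong {g = g} (λ _ _ → refl) h≈g⁻¹ i j ⟩
    (g ·ₘ g⁻¹) i j   ≈⟨ g·g⁻¹≈I i j ⟩
    I i j            ∎
    where
    h≈g⁻¹ : h ≈ₘ g⁻¹
    h≈g⁻¹ r s = begin
      h r s                ≈⟨ ·-identityʳ h r s ⟨
      (h ·ₘ I) r s         ≈⟨ ·-cong {g = h} (λ _ _ → refl) (λ a b → sym (g·g⁻¹≈I a b)) r s ⟩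
      (h ·ₘ (g ·ₘ g⁻¹)) r s ≈⟨ ·-assoc h g g⁻¹ r s ⟨
      ((h ·ₘ g) ·ₘ g⁻¹) r s ≈⟨ ·-cong {h = g⁻¹} h·g≈I (λ _ _ → refl) r s ⟩
      (I ·ₘ g⁻¹) r s       ≈⟨ ·-identityˡ g⁻¹ r s ⟩
      g⁻¹ r s              ∎

module HyperbolicForm (F : FiniteField) where
  open FiniteField F
  open Matrices F
  open import Relation.Binary.Reasoning.Setoid setoid
  open import Algebra.Properties.Group +-group using (∙-cancelˡ)
  open import Algebra.Solver.Ring.NaturalCoefficients.Default commutativeSemiring
    using (solve; _:=_; _:+_; _:*_)

  Vector : ℕ → Set
  Vector m = Fin m → Carrier

  _+ᵥ_ : ∀ {m} → Vector m → Vector m → Vector m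
  (x +ᵥ y) k = x k + y k

  unit : ∀ {m} → Fin m → Vector m
  unit q k = I k q

  column : ∀ {m} → Matrix F m → Fin m → Vector m
  column g q i = g i q

  row : ∀ {m} → Matrix F m → Fin m → Vector m
  row g p = g p

  B⁺ : ∀ n → Vector (n ℕ.+ n) → Vector (n ℕ.+ n) → Carrier
  B⁺ n x y = ∑ n (λ i → x (i ↑ˡ n) * y (n ↑ʳ i) + x (n ↑ʳ i) * y (i ↑ˡ n))

  θ⁺-cong : ∀ n {x y : Vector (n ℕ.+ n)} → (∀ k → x k ≈ y k) → θ⁺ F n x ≈ θ⁺ F n y
  θ⁺-cong n x≈y = ∑-cong n (λ i → *-cong (x≈y _) (x≈y _))

  θ⁺-+ : ∀ n (x y : Vector (n ℕ.+ n)) → θ⁺ F n (x +ᵥ y) ≈ (θ⁺ F n x + θ⁺ F n y) + B⁺ n x y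
  θ⁺-+ n x y = begin
    θ⁺ F n (x +ᵥ y)                                        ≈⟨ ∑-cong n (λ i → expand _ _ _ _) ⟩
    ∑ n (λ i → (x (i ↑ˡ n) * x (n ↑ʳ i) + y (i ↑ˡ n) * y (n ↑ʳ i))
             + (x (i ↑ˡ n) * y (n ↑ʳ i) + x (n ↑ʳ i) * y (i ↑ˡ n)))  ≈⟨ ∑-+ n _ _ ⟩
    ∑ n (λ i → x (i ↑ˡ n) * x (n ↑ʳ i) + y (i ↑ˡ n) * y (n ↑ʳ i)) + B⁺ n x y ≈⟨ +-congʳ (∑-+ n _ _) ⟩
    (θ⁺ F n x + θ⁺ F n y) + B⁺ n x y                        ∎
    where
    expand : ∀ a b c d → (a + c) * (b + d) ≈ (a * b + c * d) + (a * d + b * c)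
    expand = solve 4 (λ a b c d → ((a :+ c) :* (b :+ d)) := ((a :* b :+ c :* d) :+ (a :* d :+ b :* c))) refl

  apply-+ : ∀ {m} (g : Matrix F m) x y i → apply F g (x +ᵥ y) i ≈ apply F g x i + apply F g y i
  apply-+ {m} g x y i = trans (∑-cong m (λ k → distribˡ (g i k) (x k) (y k))) (∑-+ m _ _)

  apply-unit : ∀ {m} (g : Matrix F m) q i → apply F g (unit q) i ≈ g i q
  apply-unit {m} g q i = ∑-identityʳ m (g i) q

  Preserves-θ⁺ : ∀ n → Matrix F (n ℕ.+ n) → Set
  Preserves-θ⁺ n g = ∀ x → θ⁺ F n (apply F g x) ≈ θ⁺ F n x

  preserves-B⁺ : ∀ n {g} → Preserves-θ⁺ n g → ∀ x y → B⁺ n (apply F g x) (apply F g y) ≈ B⁺ n x y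
  preserves-B⁺ n {g} pres x y = ∙-cancelˡ (θ⁺ F n x + θ⁺ F n y) _ _ (begin
    (θ⁺ F n x + θ⁺ F n y) + B⁺ n (apply F g x) (apply F g y)
      ≈⟨ +-congʳ (+-cong (pres x) (pres y)) ⟨
    (θ⁺ F n (apply F g x) + θ⁺ F n (apply F g y)) + B⁺ n (apply F g x) (apply F g y)
      ≈⟨ θ⁺-+ n (apply F g x) (apply F g y) ⟨
    θ⁺ F n (apply F g x +ᵥ apply F g y)  ≈⟨ θ⁺-cong n (λ k → apply-+ g x y k) ⟨
    θ⁺ F n (apply F g (x +ᵥ y))          ≈⟨ pres (x +ᵥ y) ⟩
    θ⁺ F n (x +ᵥ y)                      ≈⟨ θ⁺-+ n x y ⟩
    (θ⁺ F n x + θ⁺ F n y) + B⁺ n x y     ∎)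

  B⁺-cong : ∀ n {x x′ y y′ : Vector (n ℕ.+ n)} → (∀ k → x k ≈ x′ k) → (∀ k → y k ≈ y′ k) →
    B⁺ n x y ≈ B⁺ n x′ y′
  B⁺-cong n x≈x′ y≈y′ = ∑-cong n (λ i → +-cong (*-cong (x≈x′ _) (y≈y′ _)) (*-cong (x≈x′ _) (y≈y′ _)))

  θ⁺-column : ∀ n {g} → Preserves-θ⁺ n g → ∀ q → θ⁺ F n (column g q) ≈ θ⁺ F n (unit q)
  θ⁺-column n {g} pres q = trans (θ⁺-cong n (λ k → sym (apply-unit g q k))) (pres (unit q))

  B⁺-column : ∀ n {g} → Preserves-θ⁺ n g → ∀ p q →
    B⁺ n (column g p) (column g q) ≈ B⁺ n (unit p) (unit q)
  B⁺-column n {g} pres p q =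
    trans (B⁺-cong n (λ k → sym (apply-unit g p k)) (λ k → sym (apply-unit g q k)))
          (preserves-B⁺ n {g} pres (unit p) (unit q))

module OrthogonalGroup₂ (F : FiniteField) where
  open FiniteField F
  open FieldProperties F
  open FieldSums F using (nonzeros; Unique-nonzeros; ∈-nonzeros; All-nonzeros; ∈-nonzeros⇒≉0)
  open Matrices F
  open HyperbolicForm F
  open import Relation.Binary.Reasoning.Setoid setoid
  open import Algebra.Solver.Ring.NaturalCoefficients.Default commutativeSemiring
    using (solve; _:=_; _:+_; _:*_; con)
  open Membership (MatrixSetoid F 2) using () renaming (_∈_ to _∈₂_)

  -- The conditions θ⁺(w e₀) = θ⁺(w e₁) = 0 and B⁺(w e₀, w e₁) = 1 on the columns of w.
  Relations₂ : Matrix F 2 → Set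
  Relations₂ w = (w 0F 0F * w 1F 0F ≈ 0#) × (w 0F 1F * w 1F 1F ≈ 0#)
               × (w 0F 0F * w 1F 1F + w 0F 1F * w 1F 0F ≈ 1#)

  preserves⇒Relations₂ : ∀ {w} → Preserves-θ⁺ 1 w → Relations₂ w
  preserves⇒Relations₂ {w} pres =
      trans (sym (+-identityʳ _)) (trans (θ⁺-column 1 {w} pres 0F) (trans (+-identityʳ _) (zeroʳ 1#)))
    , trans (sym (+-identityʳ _)) (trans (θ⁺-column 1 {w} pres 1F) (trans (+-identityʳ _) (zeroˡ 1#)))
    , (begin
        w 0F 0F * w 1F 1F + w 0F 1F * w 1F 0F         ≈⟨ +-congˡ (*-comm _ _) ⟩
        w 0F 0F * w 1F 1F + w 1F 0F * w 0F 1F         ≈⟨ +-identityʳ _ ⟨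
        B⁺ 1 (column w 0F) (column w 1F)             ≈⟨ B⁺-column 1 {w} pres 0F 1F ⟩
        (1# * 1# + 0# * 0#) + 0#                     ≈⟨ +-identityʳ _ ⟩
        1# * 1# + 0# * 0#                            ≈⟨ +-cong (*-identityʳ 1#) (zeroʳ 0#) ⟩
        1# + 0#                                      ≈⟨ +-identityʳ 1# ⟩
        1#                                           ∎)

  Relations₂⇒InO⁺ : ∀ {w} → Relations₂ w → InO⁺ F 1 w
  Relations₂⇒InO⁺ {w} (ac≈0 , bd≈0 , ad+bc≈1) =
    ( mat₂ d b c a
    , mat₂-≈ (1-entry refl refl) (skew≈0 ab≈0) (skew≈0 cd≈0) (1-entry′ (*-comm c b) (*-comm d a))
    , mat₂-≈ (1-entry (*-comm d a) refl) (skew≈0 (trans (*-comm d b) bd≈0))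
             (skew≈0 (trans (*-comm c a) ac≈0)) (1-entry′ (*-comm c b) refl))
    , preserves
    where
    a b c d : Carrier
    a = w 0F 0F
    b = w 0F 1F
    c = w 1F 0F
    d = w 1F 1F

    -- in O⁺(2) one of the diagonals vanishes, so the off-diagonal products below do too
    ab≈0 : a * b ≈ 0#
    ab≈0 = begin
      a * b                       ≈⟨ *-identityʳ _ ⟨
      a * b * 1#                  ≈⟨ *-congˡ ad+bc≈1 ⟨
      a * b * (a * d + b * c)     ≈⟨ solve 4 (λ a b c d → a :* b :* (a :* d :+ b :* c)
                                       := b :* d :* (a :* a) :+ a :* c :* (b :* b)) refl a b c d ⟩
      b * d * (a * a) + a * c * (b * b) ≈⟨ +-cong (*-congʳ bd≈0) (*-congʳ ac≈0) ⟩
      0# * (a * a) + 0# * (b * b) ≈⟨ +-cong (zeroˡ _) (zeroˡ _) ⟩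
      0# + 0#                     ≈⟨ +-identityʳ 0# ⟩
      0#                          ∎
    cd≈0 : c * d ≈ 0#
    cd≈0 = begin
      c * d                       ≈⟨ *-identityʳ _ ⟨
      c * d * 1#                  ≈⟨ *-congˡ ad+bc≈1 ⟨
      c * d * (a * d + b * c)     ≈⟨ solve 4 (λ a b c d → c :* d :* (a :* d :+ b :* c)
                                       := a :* c :* (d :* d) :+ b :* d :* (c :* c)) refl a b c d ⟩
      a * c * (d * d) + b * d * (c * c) ≈⟨ +-cong (*-congʳ ac≈0) (*-congʳ bd≈0) ⟩
      0# * (d * d) + 0# * (c * c) ≈⟨ +-cong (zeroˡ _) (zeroˡ _) ⟩
      0# + 0#                     ≈⟨ +-identityʳ 0# ⟩
      0#                          ∎

    skew≈0 : ∀ {x y} → x * y ≈ 0# → x * y + (y * x + 0#) ≈ 0#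
    skew≈0 xy≈0 = trans (+-cong xy≈0 (trans (+-identityʳ _) (trans (*-comm _ _) xy≈0))) (+-identityʳ 0#)

    1-entry : ∀ {x y} → x ≈ a * d → y ≈ b * c → x + (y + 0#) ≈ 1#
    1-entry x≈ad y≈bc = trans (+-cong x≈ad (trans (+-identityʳ _) y≈bc)) ad+bc≈1

    1-entry′ : ∀ {x y} → x ≈ b * c → y ≈ a * d → x + (y + 0#) ≈ 1#
    1-entry′ x≈bc y≈ad = trans (+-cong x≈bc (trans (+-identityʳ _) y≈ad)) (trans (+-comm _ _) ad+bc≈1)

    preserves : Preserves-θ⁺ 1 w
    preserves x = begin
      θ⁺ F 1 (apply F w x)
        ≈⟨ solve 6 (λ a b c d x y → ((a :* x :+ (b :* y :+ con 0)) :* (c :* x :+ (d :* y :+ con 0)) :+ con 0)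
                      := (a :* c :* (x :* x) :+ b :* d :* (y :* y) :+ (a :* d :+ b :* c) :* (x :* y)))
             refl a b c d (x 0F) (x 1F) ⟩
      a * c * (x 0F * x 0F) + b * d * (x 1F * x 1F) + (a * d + b * c) * (x 0F * x 1F)
        ≈⟨ +-cong (+-cong (*-congʳ ac≈0) (*-congʳ bd≈0)) (*-congʳ ad+bc≈1) ⟩
      0# * (x 0F * x 0F) + 0# * (x 1F * x 1F) + 1# * (x 0F * x 1F)
        ≈⟨ solve 2 (λ x y → con 0 :* (x :* x) :+ con 0 :* (y :* y) :+ con 1 :* (x :* y) := x :* y :+ con 0)
             refl (x 0F) (x 1F) ⟩
      θ⁺ F 1 x ∎

  diagonal : Carrier → Matrix F 2
  diagonal a = mat₂ a 0# 0# (a ⁻¹)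

  antidiagonal : Carrier → Matrix F 2
  antidiagonal b = mat₂ 0# b (b ⁻¹) 0#

  δ⁺₁ : ∀ w → δ⁺ F 1 w ≈ w 0F 1F * w 1F 0F
  δ⁺₁ w = trans (+-identityʳ _) (+-identityʳ _)

  diagonal-∈SO⁺ : ∀ {a} → a ≉ 0# → InSO⁺ F 1 (diagonal a)
  diagonal-∈SO⁺ {a} a≉0 = Relations₂⇒InO⁺ {diagonal a} relations , trans (δ⁺₁ (diagonal a)) (zeroʳ 0#)
    where
    relations : Relations₂ (diagonal a)
    relations = zeroʳ a , zeroˡ (a ⁻¹) , trans (+-congˡ (zeroʳ 0#)) (trans (+-identityʳ _) (inverseʳ a a≉0))

  antidiagonal-∈O⁺ : ∀ {b} → b ≉ 0# → InO⁺ F 1 (antidiagonal b)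
  antidiagonal-∈O⁺ {b} b≉0 = Relations₂⇒InO⁺ {antidiagonal b} (zeroˡ (b ⁻¹) , zeroʳ b ,
    trans (+-congʳ (zeroʳ 0#)) (trans (+-identityˡ _) (inverseʳ b b≉0)))

  module _ {w : Matrix F 2} (relations : Relations₂ w) where
    private
      ac≈0 : w 0F 0F * w 1F 0F ≈ 0#
      ac≈0 = proj₁ relations
      bd≈0 : w 0F 1F * w 1F 1F ≈ 0#
      bd≈0 = proj₁ (proj₂ relations)
      ad+bc≈1 : w 0F 0F * w 1F 1F + w 0F 1F * w 1F 0F ≈ 1#
      ad+bc≈1 = proj₂ (proj₂ relations)

    Relations₂⇒diagonal : w 0F 1F * w 1F 0F ≈ 0# → w 0F 0F ≉ 0# × w ≈ₘ diagonal (w 0F 0F)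
    Relations₂⇒diagonal bc≈0 = a≉0 , mat₂-≈ refl b≈0 c≈0 (inverse-unique ad≈1)
      where
      ad≈1 : w 0F 0F * w 1F 1F ≈ 1#
      ad≈1 = trans (sym (+-identityʳ _)) (trans (+-congˡ (sym bc≈0)) ad+bc≈1)
      a≉0 : w 0F 0F ≉ 0#
      a≉0 a≈0 = 0≉1 (trans (sym (trans (*-congʳ a≈0) (zeroˡ _))) ad≈1)
      d≉0 : w 1F 1F ≉ 0#
      d≉0 d≈0 = 0≉1 (trans (sym (trans (*-congˡ d≈0) (zeroʳ _))) ad≈1)
      b≈0 : w 0F 1F ≈ 0#
      b≈0 = *-cancelʳ d≉0 (trans bd≈0 (sym (zeroˡ _)))
      c≈0 : w 1F 0F ≈ 0#
      c≈0 = *-cancelˡ a≉0 (trans ac≈0 (sym (zeroʳ _)))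

    Relations₂⇒antidiagonal : w 0F 1F * w 1F 0F ≉ 0# → w 0F 1F ≉ 0# × w ≈ₘ antidiagonal (w 0F 1F)
    Relations₂⇒antidiagonal bc≉0 = b≉0 , mat₂-≈ a≈0 refl (inverse-unique bc≈1) d≈0
      where
      b≉0 : w 0F 1F ≉ 0#
      b≉0 b≈0 = bc≉0 (trans (*-congʳ b≈0) (zeroˡ _))
      c≉0 : w 1F 0F ≉ 0#
      c≉0 c≈0 = bc≉0 (trans (*-congˡ c≈0) (zeroʳ _))
      a≈0 : w 0F 0F ≈ 0#
      a≈0 = *-cancelʳ c≉0 (trans ac≈0 (sym (zeroˡ _)))
      d≈0 : w 1F 1F ≈ 0#
      d≈0 = *-cancelˡ b≉0 (trans bd≈0 (sym (zeroʳ _)))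
      bc≈1 : w 0F 1F * w 1F 0F ≈ 1#
      bc≈1 = trans (sym (+-identityˡ _)) (trans (+-congʳ (sym (trans (*-congʳ a≈0) (zeroˡ _)))) ad+bc≈1)

  private
    ∈-map-≉0 : ∀ (f : Carrier → Matrix F 2) → (∀ {a b} → a ≉ 0# → a ≈ b → f a ≈ₘ f b) →
      ∀ {a xs} → a ≉ 0# → Membership._∈_ setoid a xs → f a ∈₂ map f xs
    ∈-map-≉0 f f-cong a≉0 a∈xs = AnyP.map⁺ (Any.map (f-cong a≉0) a∈xs)

    diagonal-cong : ∀ {a b} → a ≉ 0# → a ≈ b → diagonal a ≈ₘ diagonal b
    diagonal-cong a≉0 a≈b = mat₂-≈ a≈b refl refl (⁻¹-cong a≉0 a≈b)

    antidiagonal-cong : ∀ {a b} → a ≉ 0# → a ≈ b → antidiagonal a ≈ₘ antidiagonal b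
    antidiagonal-cong a≉0 a≈b = mat₂-≈ refl a≈b (⁻¹-cong a≉0 a≈b) refl

  SO⁺₂ : List (Matrix F 2)
  SO⁺₂ = map diagonal nonzeros

  O⁺₂ : List (Matrix F 2)
  O⁺₂ = SO⁺₂ ++ map antidiagonal nonzeros

  Enumerates-SO⁺₂ : Enumerates (MatrixSetoid F 2) (InSO⁺ F 1) SO⁺₂
  Enumerates-SO⁺₂ = record
    { sound    = AllP.map⁺ (All.map diagonal-∈SO⁺ All-nonzeros)
    ; complete = complete
    ; unique   = Uniqueₚ.map⁺ setoid (MatrixSetoid F 2) (λ e → e 0F 0F) Unique-nonzeros
    }
    where
    complete : ∀ w → InSO⁺ F 1 w → w ∈₂ SO⁺₂
    complete w ((_ , pres) , δ≈0) =
      let a≉0 , w≈ = Relations₂⇒diagonal {w} (preserves⇒Relations₂ {w} pres) (trans (sym (δ⁺₁ w)) δ≈0) in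
      Membershipₚ.∈-resp-≈ (MatrixSetoid F 2) (λ i j → sym (w≈ i j))
        (∈-map-≉0 diagonal diagonal-cong a≉0 (∈-nonzeros a≉0))

  Enumerates-O⁺₂ : Enumerates (MatrixSetoid F 2) (InO⁺ F 1) O⁺₂
  Enumerates-O⁺₂ = record
    { sound    = AllP.++⁺ (AllP.map⁺ (All.map (proj₁ ∘ diagonal-∈SO⁺) All-nonzeros))
                          (AllP.map⁺ (All.map antidiagonal-∈O⁺ All-nonzeros))
    ; complete = complete
    ; unique   = Uniqueₚ.++⁺ (MatrixSetoid F 2) (Enumerates.unique Enumerates-SO⁺₂)
                   (Uniqueₚ.map⁺ setoid (MatrixSetoid F 2) (λ e → e 0F 1F) Unique-nonzeros) disjoint
    }
    where
    complete : ∀ w → InO⁺ F 1 w → w ∈₂ O⁺₂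
    complete w (_ , pres) with (w 0F 1F * w 1F 0F) ≟ 0#
    ... | yes bc≈0 =
      let a≉0 , w≈ = Relations₂⇒diagonal {w} (preserves⇒Relations₂ {w} pres) bc≈0 in
      Membershipₚ.∈-++⁺ˡ (MatrixSetoid F 2) (Membershipₚ.∈-resp-≈ (MatrixSetoid F 2) (λ i j → sym (w≈ i j))
        (∈-map-≉0 diagonal diagonal-cong a≉0 (∈-nonzeros a≉0)))
    ... | no bc≉0 =
      let b≉0 , w≈ = Relations₂⇒antidiagonal {w} (preserves⇒Relations₂ {w} pres) bc≉0 in
      Membershipₚ.∈-++⁺ʳ (MatrixSetoid F 2) SO⁺₂ (Membershipₚ.∈-resp-≈ (MatrixSetoid F 2) (λ i j → sym (w≈ i j))
        (∈-map-≉0 antidiagonal antidiagonal-cong b≉0 (∈-nonzeros b≉0)))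
    disjoint : ∀ {v} → ¬ (v ∈₂ SO⁺₂ × v ∈₂ map antidiagonal nonzeros)
    disjoint (v∈SO⁺₂ , v∈anti) with Membershipₚ.∈-map⁻ setoid (MatrixSetoid F 2) v∈SO⁺₂
                                  | Membershipₚ.∈-map⁻ setoid (MatrixSetoid F 2) v∈anti
    ... | a , a∈ , v≈diag | _ , _ , v≈anti = ∈-nonzeros⇒≉0 a∈ (trans (sym (v≈diag 0F 0F)) (v≈anti 0F 0F))

module TraceSums₂ (F : FiniteField) (χ : AdditiveCharacter F) where
  open FiniteField F
  open AdditiveCharacter χ
  open FieldSums F
  open Matrices F using (Tr-cong)
  open OrthogonalGroup₂ F
  open ≡.≡-Reasoning

  -- Defs defines the summand of Kloosterman in a where block; this gives it a name.
  private
    kloosterman-summand : Σ (Carrier → ℤ) λ t → Kloosterman F χ 1# ≡ ΣF t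
    kloosterman-summand = _ , ≡.refl

  Kloosterman-1 : Kloosterman F χ 1# ≡ Σ* (λ a → ψ (a + a ⁻¹))
  Kloosterman-1 = ≡.trans (proj₂ kloosterman-summand) (ΣF-cong pointwise)
    where
    pointwise : ∀ α → proj₁ kloosterman-summand α ≡ dropIf (α ≟ 0#) (ψ (α + α ⁻¹))
    pointwise α with α ≟ 0#
    ... | yes _ = ≡.refl
    ... | no _  = ψ-cong (+-congˡ (*-identityˡ _))

  private
    ψ∘Tr : ∀ {m} → Matrix F m → ℤ
    ψ∘Tr w = ψ (Tr F w)

    ψ∘Tr-cong : ∀ {m} {g h : Matrix F m} → (∀ i j → g i j ≈ h i j) → ψ∘Tr g ≡ ψ∘Tr h
    ψ∘Tr-cong g≈h = ψ-cong (Tr-cong g≈h)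

    traceSum-Enumerates : ∀ {P : Matrix F 2 → Set} {L L′} → Enumerates (MatrixSetoid F 2) P L →
      Enumerates (MatrixSetoid F 2) P L′ → traceSum F χ L ≡ traceSum F χ L′
    traceSum-Enumerates = UniqueLists.sumMap-Enumerates (MatrixSetoid F 2) ψ∘Tr ψ∘Tr-cong

    traceSum-diagonal : traceSum F χ SO⁺₂ ≡ Kloosterman F χ 1#
    traceSum-diagonal = begin
      traceSum F χ SO⁺₂                           ≡⟨ sumMap-map ψ∘Tr diagonal nonzeros ⟩
      sumMap (λ a → ψ∘Tr (diagonal a)) nonzeros   ≡⟨ sumMap-cong (λ a → ψ-cong (+-congˡ (+-identityʳ _))) nonzeros ⟩
      sumMap (λ a → ψ (a + a ⁻¹)) nonzeros        ≡⟨ sumMap-nonzeros _ ⟩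
      Σ* (λ a → ψ (a + a ⁻¹))                     ≡⟨ Kloosterman-1 ⟨
      Kloosterman F χ 1#                          ∎

    traceSum-antidiagonal : traceSum F χ (map antidiagonal nonzeros) ≡ q -ℤ 1ℤ
    traceSum-antidiagonal = begin
      traceSum F χ (map antidiagonal nonzeros)       ≡⟨ sumMap-map ψ∘Tr antidiagonal nonzeros ⟩
      sumMap (λ b → ψ∘Tr (antidiagonal b)) nonzeros  ≡⟨ sumMap-cong ψTr≡1 nonzeros ⟩
      sumMap (λ _ → 1ℤ) nonzeros                     ≡⟨ sumMap-nonzeros _ ⟩
      Σ* (λ _ → 1ℤ)                                  ≡⟨ Σ*-const 1ℤ ⟩
      q *ℤ 1ℤ -ℤ 1ℤ                                  ≡⟨ ≡.cong (_-ℤ 1ℤ) (ℤ.*-identityʳ q) ⟩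
      q -ℤ 1ℤ                                        ∎
      where
      ψTr≡1 : ∀ b → ψ∘Tr (antidiagonal b) ≡ 1ℤ
      ψTr≡1 b = ≡.trans (ψ-cong (trans (+-congˡ (+-identityʳ 0#)) (+-identityʳ 0#))) ψ-0

  traceSum-SO⁺₂ : ∀ {L} → Enumerates (MatrixSetoid F 2) (InSO⁺ F 1) L → traceSum F χ L ≡ Kloosterman F χ 1#
  traceSum-SO⁺₂ enum-L = ≡.trans (traceSum-Enumerates enum-L Enumerates-SO⁺₂) traceSum-diagonal

  traceSum-O⁺₂ : ∀ {L} → Enumerates (MatrixSetoid F 2) (InO⁺ F 1) L →
    traceSum F χ L ≡ Kloosterman F χ 1# +ℤ q -ℤ 1ℤ
  traceSum-O⁺₂ {L} enum-L = begin
    traceSum F χ L                                        ≡⟨ traceSum-Enumerates enum-L Enumerates-O⁺₂ ⟩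
    traceSum F χ O⁺₂                                      ≡⟨ sumMap-++ ψ∘Tr SO⁺₂ _ ⟩
    traceSum F χ SO⁺₂ +ℤ traceSum F χ (map antidiagonal nonzeros)
                                                          ≡⟨ ≡.cong₂ _+ℤ_ traceSum-diagonal traceSum-antidiagonal ⟩
    Kloosterman F χ 1# +ℤ (q -ℤ 1ℤ)                       ≡⟨ ℤ.+-assoc (Kloosterman F χ 1#) q (ℤ.- 1ℤ) ⟨
    Kloosterman F χ 1# +ℤ q -ℤ 1ℤ                         ∎

module SpecialLinear₂ (F : FiniteField) (char2 : HasCharacteristic2 F) where
  open FiniteField F
  open FieldProperties F
  open Characteristic2 F char2
  open FieldSums F
  open Matrices F
  open Membership (MatrixSetoid F 2) using () renaming (_∈_ to _∈₂_)
  open import Data.Product.Relation.Binary.Pointwise.NonDependent using (_×ₛ_)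
  open import Data.List using (cartesianProduct)
  open import Algebra.Properties.Group +-group using (∙-cancelˡ)

  -- the determinant, in characteristic 2
  det₂ : Matrix F 2 → Carrier
  det₂ g = g 0F 0F * g 1F 1F + g 0F 1F * g 1F 0F

  tr₂ : Matrix F 2 → Carrier
  tr₂ g = g 0F 0F + g 1F 1F

  private
    pairs : List (Carrier × Carrier)
    pairs = cartesianProduct elements elements

    rows→matrix : Carrier × Carrier → Carrier × Carrier → Matrix F 2
    rows→matrix (a , b) (c , d) = mat₂ a b c d

  matrices₂ : List (Matrix F 2)
  matrices₂ = cartesianProductWith rows→matrix pairs pairs

  SL₂ : List (Matrix F 2)
  SL₂ = filter (λ g → det₂ g ≟ 1#) matrices₂

  det₂-cong : ∀ {g h} → g ≈ₘ h → det₂ g ≈ det₂ h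
  det₂-cong g≈h = +-cong (*-cong (g≈h 0F 0F) (g≈h 1F 1F)) (*-cong (g≈h 0F 1F) (g≈h 1F 0F))

  private
    det₂≈1-resp : ∀ {g h} → g ≈ₘ h → det₂ g ≈ 1# → det₂ h ≈ 1#
    det₂≈1-resp g≈h det≈1 = trans (sym (det₂-cong g≈h)) det≈1

  ∈-SL₂ : ∀ {g} → det₂ g ≈ 1# → g ∈₂ SL₂
  ∈-SL₂ {g} det≈1 = Membershipₚ.∈-filter⁺ (MatrixSetoid F 2) (λ g → det₂ g ≟ 1#) det₂≈1-resp g∈ det≈1
    where
    ∈-pairs : ∀ a b → Membership._∈_ (setoid ×ₛ setoid) (a , b) pairs
    ∈-pairs a b = Membershipₚ.∈-cartesianProductWith⁺ setoid setoid (setoid ×ₛ setoid) _,_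
                    (∈-elements a) (∈-elements b)
    g∈ : g ∈₂ matrices₂
    g∈ = Membershipₚ.∈-resp-≈ (MatrixSetoid F 2) (mat₂-≈ refl refl refl refl)
           (Membershipₚ.∈-cartesianProductWith⁺ (setoid ×ₛ setoid) (setoid ×ₛ setoid) (MatrixSetoid F 2)
             (λ (e₀₀ , e₀₁) (e₁₀ , e₁₁) → mat₂-≈ e₀₀ e₀₁ e₁₀ e₁₁)
             (∈-pairs (g 0F 0F) (g 0F 1F)) (∈-pairs (g 1F 0F) (g 1F 1F)))

  ∈-SL₂⇒det₂≈1 : ∀ {g} → g ∈₂ SL₂ → det₂ g ≈ 1#
  ∈-SL₂⇒det₂≈1 g∈ = proj₂ (Membershipₚ.∈-filter⁻ (MatrixSetoid F 2) (λ g → det₂ g ≟ 1#) det₂≈1-resp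
                             {xs = matrices₂} g∈)

  Unique-SL₂ : UniqueS.Unique (MatrixSetoid F 2) SL₂
  Unique-SL₂ = Uniqueₚ.filter⁺ (MatrixSetoid F 2) (λ g → det₂ g ≟ 1#)
    (Uniqueₚ.cartesianProductWith⁺ (setoid ×ₛ setoid) (setoid ×ₛ setoid) (MatrixSetoid F 2) rows→matrix
      (λ e → (e 0F 0F , e 0F 1F) , (e 1F 0F , e 1F 1F)) unique-pairs unique-pairs)
    where
    unique-pairs : UniqueS.Unique (setoid ×ₛ setoid) pairs
    unique-pairs = Uniqueₚ.cartesianProduct⁺ setoid setoid (Enumerates.unique enum) (Enumerates.unique enum)

  sumMap-matrices₂ : ∀ f → sumMap f matrices₂ ≡ ΣF (λ a → ΣF (λ b → ΣF (λ c → ΣF (λ d → f (mat₂ a b c d)))))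
  sumMap-matrices₂ f = ≡.trans (sumMap-cartesianProductWith f rows→matrix pairs pairs)
    (≡.trans (sumMap-pairs _) (ΣF-cong (λ a → ΣF-cong (λ b → sumMap-pairs _))))
    where
    sumMap-pairs : ∀ g → sumMap g pairs ≡ ΣF (λ a → ΣF (λ b → g (a , b)))
    sumMap-pairs g = sumMap-cartesianProductWith g _,_ elements elements

  count-products : ∀ e v →
    ΣF (λ b → ΣF (λ c → keepIf ((b * c) ≟ e) v)) ≡ (q *ℤ v -ℤ v) +ℤ keepIf (e ≟ 0#) (q *ℤ v)
  count-products e v = begin
    ΣF (λ b → ΣF (λ c → keepIf ((b * c) ≟ e) v))
      ≡⟨ ΣF-cong fibre ⟩
    ΣF (λ b → keepIf (b ≟ 0#) (keepIf (e ≟ 0#) (q *ℤ v)) +ℤ dropIf (b ≟ 0#) v)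
      ≡⟨ ΣF-+ _ _ ⟩
    ΣF (λ b → keepIf (b ≟ 0#) (keepIf (e ≟ 0#) (q *ℤ v))) +ℤ Σ* (λ _ → v)
      ≡⟨ ≡.cong₂ _+ℤ_ (ΣF-keepIf-≟ 0# (λ _ → ≡.refl)) (Σ*-const v) ⟩
    keepIf (e ≟ 0#) (q *ℤ v) +ℤ (q *ℤ v -ℤ v)
      ≡⟨ ℤ.+-comm (keepIf (e ≟ 0#) (q *ℤ v)) _ ⟩
    (q *ℤ v -ℤ v) +ℤ keepIf (e ≟ 0#) (q *ℤ v) ∎
    where
    open ≡.≡-Reasoning
    fibre : ∀ b → ΣF (λ c → keepIf ((b * c) ≟ e) v)
                ≡ keepIf (b ≟ 0#) (keepIf (e ≟ 0#) (q *ℤ v)) +ℤ dropIf (b ≟ 0#) v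
    fibre b with b ≟ 0#
    ... | yes b≈0 = begin
      ΣF (λ c → keepIf ((b * c) ≟ e) v)   ≡⟨ ΣF-cong (λ c → keepIf-cong ((b * c) ≟ e) (e ≟ 0#)
                                             (λ bc≈e → trans (sym bc≈e) (bc≈0 c))
                                             (λ e≈0 → trans (bc≈0 c) (sym e≈0)) v) ⟩
      ΣF (λ _ → keepIf (e ≟ 0#) v)       ≡⟨ ΣF-const _ ⟩
      q *ℤ keepIf (e ≟ 0#) v             ≡⟨ keepIf-*ˡ (e ≟ 0#) q v ⟩
      keepIf (e ≟ 0#) (q *ℤ v)           ≡⟨ ℤ.+-identityʳ _ ⟨
      keepIf (e ≟ 0#) (q *ℤ v) +ℤ 0ℤ      ∎
      where
      bc≈0 : ∀ c → b * c ≈ 0#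
      bc≈0 c = trans (*-congʳ b≈0) (zeroˡ c)
    ... | no b≉0 = begin
      ΣF (λ c → keepIf ((b * c) ≟ e) v)          ≡⟨ ΣF-cong (λ c → keepIf-cong ((b * c) ≟ e) (c ≟ (b ⁻¹ * e))
                                                    (solve-c c) (λ c≈ → trans (*-congˡ c≈) b·b⁻¹e≈e) v) ⟩
      ΣF (λ c → keepIf (c ≟ (b ⁻¹ * e)) v)        ≡⟨ ΣF-keepIf-≟ (b ⁻¹ * e) (λ _ → ≡.refl) ⟩
      v                                        ≡⟨ ℤ.+-identityˡ v ⟨
      0ℤ +ℤ v                                   ∎
      where
      b·b⁻¹e≈e : b * (b ⁻¹ * e) ≈ e
      b·b⁻¹e≈e = trans (sym (*-assoc _ _ _)) (trans (*-congʳ (inverseʳ b b≉0)) (*-identityˡ e))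
      solve-c : ∀ c → b * c ≈ e → c ≈ b ⁻¹ * e
      solve-c c bc≈e = *-cancelˡ b≉0 (trans bc≈e (sym b·b⁻¹e≈e))

  private
    det-fibre : ∀ a d v → ΣF (λ b → ΣF (λ c → keepIf (det₂ (mat₂ a b c d) ≟ 1#) v))
                        ≡ (q -ℤ 1ℤ) *ℤ v +ℤ q *ℤ keepIf ((1# + a * d) ≟ 0#) v
    det-fibre a d v = begin
      ΣF (λ b → ΣF (λ c → keepIf (det₂ (mat₂ a b c d) ≟ 1#) v))
        ≡⟨ ΣF-cong (λ b → ΣF-cong (λ c → keepIf-cong (det₂ (mat₂ a b c d) ≟ 1#) ((b * c) ≟ (1# + a * d))
             (λ det≈1 → trans (sym (x+y+x≈y (a * d) (b * c))) (+-congʳ det≈1))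
             (λ bc≈ → trans (+-congˡ bc≈) (trans (sym (+-assoc _ _ _)) (x+y+x≈y (a * d) 1#))) v)) ⟩
      ΣF (λ b → ΣF (λ c → keepIf ((b * c) ≟ (1# + a * d)) v))
        ≡⟨ count-products (1# + a * d) v ⟩
      (q *ℤ v -ℤ v) +ℤ keepIf ((1# + a * d) ≟ 0#) (q *ℤ v)
        ≡⟨ ≡.cong₂ _+ℤ_ (rearrange q v) (keepIf-*ˡ ((1# + a * d) ≟ 0#) q v) ⟨
      (q -ℤ 1ℤ) *ℤ v +ℤ q *ℤ keepIf ((1# + a * d) ≟ 0#) v ∎
      where
      open ≡.≡-Reasoning
      rearrange : ∀ q v → (q -ℤ 1ℤ) *ℤ v ≡ q *ℤ v -ℤ v
      rearrange = solve-∀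

    inverse-fibre : ∀ (φ : Carrier → ℤ) → Congruent φ → ∀ a →
      ΣF (λ d → keepIf ((1# + a * d) ≟ 0#) (φ (a + d))) ≡ dropIf (a ≟ 0#) (φ (a + a ⁻¹))
    inverse-fibre φ φ-cong a with a ≟ 0#
    ... | yes a≈0 = sumMap-zero vanishes elements
      where
      vanishes : ∀ d → keepIf ((1# + a * d) ≟ 0#) (φ (a + d)) ≡ 0ℤ
      vanishes d with (1# + a * d) ≟ 0#
      ... | yes 1+ad≈0 = ⊥-elim (0≉1 (sym (trans (sym (trans (+-congˡ (trans (*-congʳ a≈0) (zeroˡ d)))
                                                                 (+-identityʳ 1#))) 1+ad≈0)))
      ... | no _        = ≡.refl
    ... | no a≉0 = ≡.trans (ΣF-cong (λ d → keepIf-cong ((1# + a * d) ≟ 0#) (d ≟ (a ⁻¹))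
                      (λ 1+ad≈0 → inverse-unique (sym (x+y≈0⇒x≈y 1+ad≈0)))
                      (λ d≈a⁻¹ → trans (+-congˡ (trans (*-congˡ d≈a⁻¹) (inverseʳ a a≉0))) char2) (φ (a + d))))
                    (ΣF-keepIf-≟ (a ⁻¹) (λ d≈d′ → φ-cong (+-congˡ d≈d′)))

  traceSum-SL₂ : ∀ (φ : Carrier → ℤ) → Congruent φ →
    sumMap (λ g → φ (tr₂ g)) SL₂ ≡ q²-q *ℤ ΣF φ +ℤ q *ℤ Σ* (λ a → φ (a + a ⁻¹))
  traceSum-SL₂ φ φ-cong = begin
    sumMap (λ g → φ (tr₂ g)) SL₂
      ≡⟨ ≡.trans (sumMap-filter (λ g → det₂ g ≟ 1#) _ matrices₂) (sumMap-matrices₂ _) ⟩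
    ΣF (λ a → ΣF (λ b → ΣF (λ c → ΣF (λ d → X a b c d))))
      ≡⟨ ΣF-cong (λ a → ≡.trans (ΣF-cong (λ b → ΣF-swap (X a b))) (ΣF-swap (λ b d → ΣF (λ c → X a b c d)))) ⟩
    ΣF (λ a → ΣF (λ d → ΣF (λ b → ΣF (λ c → X a b c d))))
      ≡⟨ ΣF-cong (λ a → ΣF-cong (λ d → det-fibre a d (φ (a + d)))) ⟩
    ΣF (λ a → ΣF (λ d → (q -ℤ 1ℤ) *ℤ φ (a + d) +ℤ q *ℤ Y a d))
      ≡⟨ ≡.trans (ΣF-cong (λ a → ΣF-linear (q -ℤ 1ℤ) (λ d → φ (a + d)) q (λ d → Y a d)))
                 (ΣF-linear (q -ℤ 1ℤ) _ q _) ⟩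
    (q -ℤ 1ℤ) *ℤ ΣF (λ a → ΣF (λ d → φ (a + d))) +ℤ q *ℤ ΣF (λ a → ΣF (λ d → Y a d))
      ≡⟨ ≡.cong₂ (λ s t → (q -ℤ 1ℤ) *ℤ s +ℤ q *ℤ t)
           (≡.trans (ΣF-cong (λ a → ΣF-reindex (λ d → a + d) +-congˡ (λ {x} {y} → ∙-cancelˡ a x y) φ-cong))
                    (ΣF-const _))
           (ΣF-cong (inverse-fibre φ φ-cong)) ⟩
    (q -ℤ 1ℤ) *ℤ (q *ℤ ΣF φ) +ℤ q *ℤ Σ* (λ a → φ (a + a ⁻¹))
      ≡⟨ ≡.cong (_+ℤ q *ℤ Σ* (λ a → φ (a + a ⁻¹))) (rearrange q (ΣF φ)) ⟩
    q²-q *ℤ ΣF φ +ℤ q *ℤ Σ* (λ a → φ (a + a ⁻¹)) ∎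
    where
    open ≡.≡-Reasoning
    X : Carrier → Carrier → Carrier → Carrier → ℤ
    X a b c d = keepIf (det₂ (mat₂ a b c d) ≟ 1#) (φ (a + d))
    Y : Carrier → Carrier → ℤ
    Y a d = keepIf ((1# + a * d) ≟ 0#) (φ (a + d))
    rearrange : ∀ q s → (q -ℤ 1ℤ) *ℤ (q *ℤ s) ≡ (q *ℤ (q -ℤ 1ℤ)) *ℤ s
    rearrange = solve-∀

module TraceProductSum (F : FiniteField) (χ : AdditiveCharacter F) (nontrivial : Nontrivial χ) where
  open FiniteField F
  open AdditiveCharacter χ
  open FieldProperties F
  open FieldSums F
  open Characters F χ
  private
    char2 : HasCharacteristic2 F
    char2 = nontrivial⇒characteristic2 nontrivial
  open Characteristic2 F char2
  open SpecialLinear₂ F char2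
  open TraceSums₂ F χ using (Kloosterman-1)
  open 𝔽₂-Solver using (solve; _:=_; _:+_; _:*_)

  u : Carrier → Carrier
  u a = a + a ⁻¹

  K : ℤ
  K = Σ* (λ a → ψ (u a))

  u-cong : ∀ {x y} → x ≉ 0# → x ≈ y → u x ≈ u y
  u-cong x≉0 x≈y = +-cong x≈y (⁻¹-cong x≉0 x≈y)

  u≈0⇔≈1 : ∀ {b} → b ≉ 0# → (u b ≈ 0# → b ≈ 1#) × (b ≈ 1# → u b ≈ 0#)
  u≈0⇔≈1 {b} b≉0 =
      (λ ub≈0 → square-injective
                  (trans (*-congˡ (x+y≈0⇒x≈y ub≈0)) (trans (inverseʳ b b≉0) (sym (*-identityʳ 1#)))))
    , (λ b≈1 → trans (+-cong b≈1 (trans (⁻¹-cong b≉0 b≈1) 1⁻¹≈1)) char2)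

  -- the substitution b = a⁻¹ c splits u(a) u(b) as u(c) + u(a² c⁻¹)
  u-product : ∀ {a c} → a ≉ 0# → c ≉ 0# → u a * u (a ⁻¹ * c) ≈ u c + u (a * a * c ⁻¹)
  u-product {a} {c} a≉0 c≉0 = begin
    (a + a⁻¹) * (a⁻¹ * c + (a⁻¹ * c) ⁻¹)   ≈⟨ *-congˡ (+-congˡ (⁻¹-product-swap)) ⟩
    (a + a⁻¹) * (a⁻¹ * c + a * c⁻¹)        ≈⟨ solve 4 (λ a a⁻¹ c c⁻¹ → (a :+ a⁻¹) :* (a⁻¹ :* c :+ a :* c⁻¹)
                                                := (a :* a⁻¹ :* c :+ a :* a⁻¹ :* c⁻¹) :+ (a :* a :* c⁻¹ :+ a⁻¹ :* a⁻¹ :* c))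
                                                refl a a⁻¹ c c⁻¹ ⟩
    (a * a⁻¹ * c + a * a⁻¹ * c⁻¹) + (a * a * c⁻¹ + a⁻¹ * a⁻¹ * c)
      ≈⟨ +-cong (+-cong (cancel c) (cancel c⁻¹)) (+-congˡ (sym ⁻¹-a²c⁻¹)) ⟩
    (c + c⁻¹) + (a * a * c⁻¹ + (a * a * c⁻¹) ⁻¹) ∎
    where
    open import Relation.Binary.Reasoning.Setoid setoid
    a⁻¹ c⁻¹ : Carrier
    a⁻¹ = a ⁻¹
    c⁻¹ = c ⁻¹
    cancel : ∀ x → a * a⁻¹ * x ≈ x
    cancel x = trans (*-congʳ (inverseʳ a a≉0)) (*-identityˡ x)
    ⁻¹-product-swap : (a⁻¹ * c) ⁻¹ ≈ a * c⁻¹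
    ⁻¹-product-swap = sym (inverse-unique (begin
      a⁻¹ * c * (a * c⁻¹)   ≈⟨ solve 4 (λ a a⁻¹ c c⁻¹ → a⁻¹ :* c :* (a :* c⁻¹) := a :* a⁻¹ :* (c :* c⁻¹))
                                 refl a a⁻¹ c c⁻¹ ⟩
      a * a⁻¹ * (c * c⁻¹)   ≈⟨ trans (cancel _) (inverseʳ c c≉0) ⟩
      1#                   ∎))
    ⁻¹-a²c⁻¹ : (a * a * c⁻¹) ⁻¹ ≈ a⁻¹ * a⁻¹ * c
    ⁻¹-a²c⁻¹ = sym (inverse-unique (begin
      a * a * c⁻¹ * (a⁻¹ * a⁻¹ * c)   ≈⟨ solve 4 (λ a a⁻¹ c c⁻¹ → a :* a :* c⁻¹ :* (a⁻¹ :* a⁻¹ :* c)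
                                          := a :* a⁻¹ :* (a :* a⁻¹ :* (c :* c⁻¹))) refl a a⁻¹ c c⁻¹ ⟩
      a * a⁻¹ * (a * a⁻¹ * (c * c⁻¹)) ≈⟨ trans (cancel _) (trans (cancel _) (inverseʳ c c≉0)) ⟩
      1#                             ∎))

  private
    ψ∘u-cong : ∀ s → Congruent* (λ b → ψ (s * u b))
    ψ∘u-cong s x≉0 x≈y = ψ-cong (*-congˡ (u-cong x≉0 x≈y))

    Σ*-dilate : ∀ {c} → c ≉ 0# → ∀ {f} → Congruent* f → Σ* (λ x → f (c * x)) ≡ Σ* f
    Σ*-dilate {c} c≉0 =
      Σ*-reindex (c *_) *-congˡ (*-cancelˡ c≉0) cx≈0⇒x≈0 (λ x≈0 → trans (*-congˡ x≈0) (zeroʳ c))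
      where
      cx≈0⇒x≈0 : ∀ {x} → c * x ≈ 0# → x ≈ 0#
      cx≈0⇒x≈0 cx≈0 = *-cancelˡ c≉0 (trans cx≈0 (sym (zeroʳ c)))

    Σ*-square : ∀ {f} → Congruent* f → Σ* (λ x → f (x * x)) ≡ Σ* f
    Σ*-square = Σ*-reindex (λ x → x * x) (λ x≈y → *-cong x≈y x≈y) square-injective
      (λ x²≈0 → square-injective (trans x²≈0 (sym (zeroʳ 0#)))) (λ x≈0 → trans (*-congˡ x≈0) (zeroʳ _))

  Σ*-ψ-u-product : Σ* (λ a → Σ* (λ b → ψ (u a * u b))) ≡ K *ℤ K
  Σ*-ψ-u-product = begin
    Σ* (λ a → Σ* (λ b → ψ (u a * u b)))                        ≡⟨ Σ*-cong substitute ⟩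
    Σ* (λ a → Σ* (λ c → ψ (u c) *ℤ ψ (u (a * a * c ⁻¹))))        ≡⟨ Σ*-swap _ ⟩
    Σ* (λ c → Σ* (λ a → ψ (u c) *ℤ ψ (u (a * a * c ⁻¹))))        ≡⟨ Σ*-cong (λ c c≉0 →
                                                                     ≡.trans (Σ*-*ˡ (ψ (u c)) (λ a → ψ (u (a * a * c ⁻¹))))
                                                                             (≡.cong (ψ (u c) *ℤ_) (inner c≉0))) ⟩
    Σ* (λ c → ψ (u c) *ℤ K)                                     ≡⟨ Σ*-cong (λ c _ → ℤ.*-comm (ψ (u c)) K) ⟩
    Σ* (λ c → K *ℤ ψ (u c))                                     ≡⟨ Σ*-*ˡ K _ ⟩
    K *ℤ K                                                      ∎
    where
    open ≡.≡-Reasoning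
    substitute : ∀ a → a ≉ 0# → Σ* (λ b → ψ (u a * u b)) ≡ Σ* (λ c → ψ (u c) *ℤ ψ (u (a * a * c ⁻¹)))
    substitute a a≉0 = ≡.trans (≡.sym (Σ*-dilate (⁻¹-≉0 a≉0) (ψ∘u-cong (u a))))
      (Σ*-cong (λ c c≉0 → ≡.trans (ψ-cong (u-product a≉0 c≉0)) (ψ-hom _ _)))
    inner : ∀ {c} → c ≉ 0# → Σ* (λ a → ψ (u (a * a * c ⁻¹))) ≡ K
    inner {c} c≉0 = ≡.trans (Σ*-square ψ∘u-c⁻¹-cong)
      (≡.trans (Σ*-cong (λ x x≉0 → ψ-cong (u-cong (*-≉0 x≉0 (⁻¹-≉0 c≉0)) (*-comm _ _))))
               (Σ*-dilate (⁻¹-≉0 c≉0) (λ x≉0 x≈y → ψ-cong (u-cong x≉0 x≈y))))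
      where
      ψ∘u-c⁻¹-cong : Congruent* (λ x → ψ (u (x * c ⁻¹)))
      ψ∘u-c⁻¹-cong x≉0 x≈y = ψ-cong (u-cong (*-≉0 x≉0 (⁻¹-≉0 c≉0)) (*-congʳ x≈y))

  Σ*-keepIf-u≈0 : ∀ v → Σ* (λ b → keepIf (u b ≟ 0#) v) ≡ v
  Σ*-keepIf-u≈0 v = ≡.trans (ΣF-cong only-1) (ΣF-keepIf-≟ 1# (λ _ → ≡.refl))
    where
    only-1 : ∀ b → dropIf (b ≟ 0#) (keepIf (u b ≟ 0#) v) ≡ keepIf (b ≟ 1#) v
    only-1 b with b ≟ 0# | b ≟ 1#
    ... | yes b≈0 | yes b≈1 = ⊥-elim (0≉1 (trans (sym b≈0) b≈1))
    ... | yes _   | no _    = ≡.refl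
    ... | no b≉0  | b≟1     = keepIf-cong (u b ≟ 0#) b≟1 (proj₁ (u≈0⇔≈1 b≉0)) (proj₂ (u≈0⇔≈1 b≉0)) v

  private
    -- the sum over h ∈ SL₂ of ψ(s · tr h), by traceSum-SL₂
    Ψ : Carrier → ℤ
    Ψ s = q²-q *ℤ keepIf (s ≟ 0#) q +ℤ q *ℤ Σ* (λ b → ψ (s * u b))

    Ψ-cong : Congruent Ψ
    Ψ-cong {s} {s′} s≈s′ = ≡.cong₂ (λ x y → q²-q *ℤ x +ℤ q *ℤ y)
      (keepIf-cong (s ≟ 0#) (s′ ≟ 0#) (trans (sym s≈s′)) (trans s≈s′) q)
      (Σ*-cong (λ b _ → ψ-cong (*-congʳ s≈s′)))

    inner-sum : ∀ s → sumMap (λ h → ψ (s * tr₂ h)) SL₂ ≡ Ψ s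
    inner-sum s = ≡.trans (traceSum-SL₂ (λ t → ψ (s * t)) (λ t≈t′ → ψ-cong (*-congˡ t≈t′)))
      (≡.cong (λ x → q²-q *ℤ x +ℤ q *ℤ Σ* (λ b → ψ (s * u b))) (ΣF-ψ-* nontrivial s))

    ΣF-Ψ : ΣF Ψ ≡ q²-q *ℤ q +ℤ q *ℤ q
    ΣF-Ψ = begin
      ΣF Ψ                                       ≡⟨ ΣF-linear q²-q _ q _ ⟩
      q²-q *ℤ ΣF (λ s → keepIf (s ≟ 0#) q) +ℤ q *ℤ ΣF (λ s → Σ* (λ b → ψ (s * u b)))
        ≡⟨ ≡.cong₂ (λ x y → q²-q *ℤ x +ℤ q *ℤ y) (ΣF-keepIf-≟ 0# (λ _ → ≡.refl)) (ΣF-Σ*-swap _) ⟩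
      q²-q *ℤ q +ℤ q *ℤ Σ* (λ b → ΣF (λ s → ψ (s * u b)))
        ≡⟨ ≡.cong (λ y → q²-q *ℤ q +ℤ q *ℤ y) (≡.trans (Σ*-cong (λ b _ →
             ≡.trans (ΣF-cong (λ s → ψ-cong (*-comm s (u b)))) (ΣF-ψ-* nontrivial (u b)))) (Σ*-keepIf-u≈0 q)) ⟩
      q²-q *ℤ q +ℤ q *ℤ q             ∎
      where open ≡.≡-Reasoning

    Σ*-Ψ∘u : Σ* (λ a → Ψ (u a)) ≡ q²-q *ℤ q +ℤ q *ℤ (K *ℤ K)
    Σ*-Ψ∘u = ≡.trans (Σ*-linear q²-q _ q _)
      (≡.cong₂ (λ x y → q²-q *ℤ x +ℤ q *ℤ y) (Σ*-keepIf-u≈0 q) Σ*-ψ-u-product)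

  traceProductSum-SL₂ : sumMap (λ g → sumMap (λ h → ψ (tr₂ g * tr₂ h)) SL₂) SL₂
    ≡ (q *ℤ q) *ℤ (Kloosterman F χ 1# *ℤ Kloosterman F χ 1# +ℤ q *ℤ q *ℤ q -ℤ q)
  traceProductSum-SL₂ = begin
    sumMap (λ g → sumMap (λ h → ψ (tr₂ g * tr₂ h)) SL₂) SL₂   ≡⟨ sumMap-cong (λ g → inner-sum (tr₂ g)) SL₂ ⟩
    sumMap (λ g → Ψ (tr₂ g)) SL₂                            ≡⟨ traceSum-SL₂ Ψ Ψ-cong ⟩
    q²-q *ℤ ΣF Ψ +ℤ q *ℤ Σ* (λ a → Ψ (u a))       ≡⟨ ≡.cong₂ (λ x y → q²-q *ℤ x +ℤ q *ℤ y)
                                                                   ΣF-Ψ Σ*-Ψ∘u ⟩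
    q²-q *ℤ (q²-q *ℤ q +ℤ q *ℤ q) +ℤ q *ℤ (q²-q *ℤ q +ℤ q *ℤ (K *ℤ K))
                                                            ≡⟨ simplify q K ⟩
    (q *ℤ q) *ℤ (K *ℤ K +ℤ q *ℤ q *ℤ q -ℤ q)                  ≡⟨ ≡.cong (λ k → (q *ℤ q) *ℤ (k *ℤ k +ℤ q *ℤ q *ℤ q -ℤ q))
                                                                   Kloosterman-1 ⟨
    (q *ℤ q) *ℤ (Kloosterman F χ 1# *ℤ Kloosterman F χ 1# +ℤ q *ℤ q *ℤ q -ℤ q) ∎
    where
    open ≡.≡-Reasoning
    simplify : ∀ q K → (q *ℤ (q -ℤ 1ℤ)) *ℤ ((q *ℤ (q -ℤ 1ℤ)) *ℤ q +ℤ q *ℤ q)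
                       +ℤ q *ℤ ((q *ℤ (q -ℤ 1ℤ)) *ℤ q +ℤ q *ℤ (K *ℤ K))
                     ≡ (q *ℤ q) *ℤ (K *ℤ K +ℤ q *ℤ q *ℤ q -ℤ q)
    simplify = solve-∀

-- The expressions below are written over an arbitrary signature so that they can be read both
-- in the field and as polynomials for the solver, with the same normal form after evaluation.
module Forms₄ (R : RawSemiring 0ℓ 0ℓ) where
  open RawSemiring R renaming (Carrier to A)

  θ : (Fin 4 → A) → A
  θ v = v 0F * v 2F + (v 1F * v 3F + 0#)

  B : (Fin 4 → A) → (Fin 4 → A) → A
  B x y = (x 0F * y 2F + x 2F * y 0F) + ((x 1F * y 3F + x 3F * y 1F) + 0#)

  unit : Fin 4 → Fin 4 → A
  unit q k with k Fin.≟ q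
  ... | yes _ = 1#
  ... | no _  = 0#

  module _ (a : Fin 4 → Fin 4 → A) where

    column row : Fin 4 → Fin 4 → A
    column q i = a i q
    row p = a p

    δ : A
    δ = (a 0F 2F * a 2F 0F + (a 0F 3F * a 2F 1F + 0#)) + ((a 1F 2F * a 3F 0F + (a 1F 3F * a 3F 1F + 0#)) + 0#)

    -- 2 × 2 minors of a; for a = g ⊗ h they are the squares of the entries of g and of h
    minorᴳ minorᴴ : Fin 2 → Fin 2 → A
    minorᴳ 0F 0F = a 0F 0F * a 1F 1F + a 0F 1F * a 1F 0F
    minorᴳ 0F 1F = a 0F 3F * a 1F 2F + a 0F 2F * a 1F 3F
    minorᴳ 1F 0F = a 3F 0F * a 2F 1F + a 3F 1F * a 2F 0F
    minorᴳ 1F 1F = a 3F 3F * a 2F 2F + a 3F 2F * a 2F 3F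
    minorᴴ 0F 0F = a 0F 0F * a 3F 3F + a 0F 3F * a 3F 0F
    minorᴴ 0F 1F = a 0F 1F * a 3F 2F + a 0F 2F * a 3F 1F
    minorᴴ 1F 0F = a 1F 0F * a 2F 3F + a 1F 3F * a 2F 0F
    minorᴴ 1F 1F = a 1F 1F * a 2F 2F + a 1F 2F * a 2F 1F

-- F⁴ is identified with the 2 × 2 matrices via x ↦ [[x₀, x₁], [x₃, x₂]]: position p holds the
-- entry (π₁ p, π₂ p).  Then θ⁺ becomes the determinant (in characteristic 2) and g ⊗ h acts
-- as X ↦ g X hᵀ.
module TensorProduct (F : FiniteField) (char2 : HasCharacteristic2 F) where
  open FiniteField F
  open FieldProperties F
  open Characteristic2 F char2
  open 𝔽₂-Solver using (solve; _:=_; _:+_; _:*_; con)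
  open Matrices F
  open SpecialLinear₂ F char2 using (det₂; tr₂)
  open import Relation.Binary.Reasoning.Setoid setoid

  π₁ π₂ : Fin 4 → Fin 2
  π₁ 0F = 0F
  π₁ 1F = 0F
  π₁ 2F = 1F
  π₁ 3F = 1F
  π₂ 0F = 0F
  π₂ 1F = 1F
  π₂ 2F = 1F
  π₂ 3F = 0F

  infixl 7 _⊗_
  _⊗_ : Matrix F 2 → Matrix F 2 → Matrix F 4
  (g ⊗ h) p q = g (π₁ p) (π₁ q) * h (π₂ p) (π₂ q)

  ⊗-cong : ∀ {g g′ h h′} → g ≈ₘ g′ → h ≈ₘ h′ → g ⊗ h ≈ₘ g′ ⊗ h′
  ⊗-cong g≈g′ h≈h′ p q = *-cong (g≈g′ (π₁ p) (π₁ q)) (h≈h′ (π₂ p) (π₂ q))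

  ⊗-· : ∀ g h g′ h′ → (g ⊗ h) ·ₘ (g′ ⊗ h′) ≈ₘ (g ·ₘ g′) ⊗ (h ·ₘ h′)
  ⊗-· g h g′ h′ p q = trans
    (expand (g (π₁ p) 0F) (g (π₁ p) 1F) (g′ 0F (π₁ q)) (g′ 1F (π₁ q))
            (h (π₂ p) 0F) (h (π₂ p) 1F) (h′ 0F (π₂ q)) (h′ 1F (π₂ q)))
    (sym (*-cong (+-congˡ (+-identityʳ _)) (+-congˡ (+-identityʳ _))))
    where
    expand : ∀ x₀ x₁ y₀ y₁ z₀ z₁ t₀ t₁ →
      x₀ * z₀ * (y₀ * t₀) + (x₀ * z₁ * (y₀ * t₁) + (x₁ * z₁ * (y₁ * t₁) + (x₁ * z₀ * (y₁ * t₀) + 0#)))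
      ≈ (x₀ * y₀ + x₁ * y₁) * (z₀ * t₀ + z₁ * t₁)
    expand = solve 8 (λ x₀ x₁ y₀ y₁ z₀ z₁ t₀ t₁ →
      x₀ :* z₀ :* (y₀ :* t₀) :+ (x₀ :* z₁ :* (y₀ :* t₁)
        :+ (x₁ :* z₁ :* (y₁ :* t₁) :+ (x₁ :* z₀ :* (y₁ :* t₀) :+ con false)))
      := (x₀ :* y₀ :+ x₁ :* y₁) :* (z₀ :* t₀ :+ z₁ :* t₁)) refl

  private
    1·1≈1 : 1# * 1# ≈ 1#
    1·1≈1 = *-identityʳ 1#
    1·0≈0 : 1# * 0# ≈ 0#
    1·0≈0 = zeroʳ 1#
    0·1≈0 : 0# * 1# ≈ 0#
    0·1≈0 = zeroˡ 1#
    0·0≈0 : 0# * 0# ≈ 0#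
    0·0≈0 = zeroʳ 0#

  ⊗-identity : I ⊗ I ≈ₘ I
  ⊗-identity 0F 0F = 1·1≈1
  ⊗-identity 0F 1F = 1·0≈0
  ⊗-identity 0F 2F = 0·0≈0
  ⊗-identity 0F 3F = 0·1≈0
  ⊗-identity 1F 0F = 1·0≈0
  ⊗-identity 1F 1F = 1·1≈1
  ⊗-identity 1F 2F = 0·1≈0
  ⊗-identity 1F 3F = 0·0≈0
  ⊗-identity 2F 0F = 0·0≈0
  ⊗-identity 2F 1F = 0·1≈0
  ⊗-identity 2F 2F = 1·1≈1
  ⊗-identity 2F 3F = 1·0≈0
  ⊗-identity 3F 0F = 0·1≈0
  ⊗-identity 3F 1F = 0·0≈0
  ⊗-identity 3F 2F = 1·0≈0
  ⊗-identity 3F 3F = 1·1≈1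

  -- the adjugate, in characteristic 2
  adj₂ : Matrix F 2 → Matrix F 2
  adj₂ g = mat₂ (g 1F 1F) (g 0F 1F) (g 1F 0F) (g 0F 0F)

  module _ (g : Matrix F 2) (det≈1 : det₂ g ≈ 1#) where
    private
      a b c d : Carrier
      a = g 0F 0F
      b = g 0F 1F
      c = g 1F 0F
      d = g 1F 1F

      antisymmetric : ∀ x y → x * y + (y * x + 0#) ≈ 0#
      antisymmetric = solve 2 (λ x y → x :* y :+ (y :* x :+ con false) := con false) refl

    ·-adj₂ : g ·ₘ adj₂ g ≈ₘ I
    ·-adj₂ = mat₂-≈
      (trans (solve 4 (λ a b c d → a :* d :+ (b :* c :+ con false) := a :* d :+ b :* c) refl a b c d) det≈1)
      (antisymmetric a b) (antisymmetric c d)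
      (trans (solve 4 (λ a b c d → c :* b :+ (d :* a :+ con false) := a :* d :+ b :* c) refl a b c d) det≈1)

    adj₂-· : adj₂ g ·ₘ g ≈ₘ I
    adj₂-· = mat₂-≈
      (trans (solve 4 (λ a b c d → d :* a :+ (b :* c :+ con false) := a :* d :+ b :* c) refl a b c d) det≈1)
      (antisymmetric d b) (antisymmetric c a)
      (trans (solve 4 (λ a b c d → c :* b :+ (a :* d :+ con false) := a :* d :+ b :* c) refl a b c d) det≈1)

  ⊗-invertible : ∀ g h → det₂ g ≈ 1# → det₂ h ≈ 1# → Invertible F (g ⊗ h)
  ⊗-invertible g h det-g det-h = adj₂ g ⊗ adj₂ h
    , (λ p q → trans (⊗-· g h (adj₂ g) (adj₂ h) p q)
                 (trans (⊗-cong (·-adj₂ g det-g) (·-adj₂ h det-h) p q) (⊗-identity p q)))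
    , (λ p q → trans (⊗-· (adj₂ g) (adj₂ h) g h p q)
                 (trans (⊗-cong (adj₂-· g det-g) (adj₂-· h det-h) p q) (⊗-identity p q)))

  θ⁺-⊗ : ∀ g h x → θ⁺ F 2 (apply F (g ⊗ h) x) ≈ (det₂ g * det₂ h) * θ⁺ F 2 x
  θ⁺-⊗ g h x = solve 12 (λ g₀₀ g₀₁ g₁₀ g₁₁ h₀₀ h₀₁ h₁₀ h₁₁ x₀ x₁ x₂ x₃ →
      (g₀₀ :* h₀₀ :* x₀ :+ (g₀₀ :* h₀₁ :* x₁ :+ (g₀₁ :* h₀₁ :* x₂ :+ (g₀₁ :* h₀₀ :* x₃ :+ con false))))
        :* (g₁₀ :* h₁₀ :* x₀ :+ (g₁₀ :* h₁₁ :* x₁ :+ (g₁₁ :* h₁₁ :* x₂ :+ (g₁₁ :* h₁₀ :* x₃ :+ con false))))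
      :+ ((g₀₀ :* h₁₀ :* x₀ :+ (g₀₀ :* h₁₁ :* x₁ :+ (g₀₁ :* h₁₁ :* x₂ :+ (g₀₁ :* h₁₀ :* x₃ :+ con false))))
        :* (g₁₀ :* h₀₀ :* x₀ :+ (g₁₀ :* h₀₁ :* x₁ :+ (g₁₁ :* h₀₁ :* x₂ :+ (g₁₁ :* h₀₀ :* x₃ :+ con false))))
      :+ con false)
    := (g₀₀ :* g₁₁ :+ g₀₁ :* g₁₀) :* (h₀₀ :* h₁₁ :+ h₀₁ :* h₁₀) :* (x₀ :* x₂ :+ (x₁ :* x₃ :+ con false)))
    refl (g 0F 0F) (g 0F 1F) (g 1F 0F) (g 1F 1F) (h 0F 0F) (h 0F 1F) (h 1F 0F) (h 1F 1F) (x 0F) (x 1F) (x 2F) (x 3F)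

  δ⁺-⊗ : ∀ g h → δ⁺ F 2 (g ⊗ h) ≈ 0#
  δ⁺-⊗ g h = solve 8 (λ g₀₀ g₀₁ g₁₀ g₁₁ h₀₀ h₀₁ h₁₀ h₁₁ →
      (g₀₁ :* h₀₁ :* (g₁₀ :* h₁₀) :+ (g₀₁ :* h₀₀ :* (g₁₀ :* h₁₁) :+ con false))
      :+ ((g₀₁ :* h₁₁ :* (g₁₀ :* h₀₀) :+ (g₀₁ :* h₁₀ :* (g₁₀ :* h₀₁) :+ con false)) :+ con false)
    := con false) refl (g 0F 0F) (g 0F 1F) (g 1F 0F) (g 1F 1F) (h 0F 0F) (h 0F 1F) (h 1F 0F) (h 1F 1F)

  Tr-⊗ : ∀ g h → Tr F (g ⊗ h) ≈ tr₂ g * tr₂ h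
  Tr-⊗ g h = solve 4 (λ g₀₀ g₁₁ h₀₀ h₁₁ →
      g₀₀ :* h₀₀ :+ (g₀₀ :* h₁₁ :+ (g₁₁ :* h₁₁ :+ (g₁₁ :* h₀₀ :+ con false)))
    := (g₀₀ :+ g₁₁) :* (h₀₀ :+ h₁₁)) refl (g 0F 0F) (g 1F 1F) (h 0F 0F) (h 1F 1F)

  ⊗-∈SO⁺ : ∀ g h → det₂ g ≈ 1# → det₂ h ≈ 1# → InSO⁺ F 2 (g ⊗ h)
  ⊗-∈SO⁺ g h det-g det-h = (⊗-invertible g h det-g det-h , preserves) , δ⁺-⊗ g h
    where
    preserves : ∀ x → θ⁺ F 2 (apply F (g ⊗ h) x) ≈ θ⁺ F 2 x
    preserves x = trans (θ⁺-⊗ g h x) (trans (*-congʳ (trans (*-cong det-g det-h) 1·1≈1)) (*-identityˡ _))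

  private
    factor-scalar : ∀ {x x′ a₀ a₁ a₀′ a₁′ b₀ b₁} → a₀ * b₀ + a₁ * b₁ ≈ 1# →
      x * a₀ ≈ x′ * a₀′ →
      x * a₁ ≈ x′ * a₁′ → x ≈ x′ * (a₀′ * b₀ + a₁′ * b₁)
    factor-scalar {x} {x′} {a₀} {a₁} {a₀′} {a₁′} {b₀} {b₁} det≈1 e₀ e₁ = begin
      x                               ≈⟨ *-identityʳ x ⟨
      x * 1#                          ≈⟨ *-congˡ det≈1 ⟨
      x * (a₀ * b₀ + a₁ * b₁)         ≈⟨ distribute x a₀ a₁ b₀ b₁ ⟩
      x * a₀ * b₀ + x * a₁ * b₁       ≈⟨ +-cong (*-congʳ e₀) (*-congʳ e₁) ⟩
      x′ * a₀′ * b₀ + x′ * a₁′ * b₁   ≈⟨ distribute x′ a₀′ a₁′ b₀ b₁ ⟨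
      x′ * (a₀′ * b₀ + a₁′ * b₁)      ∎
      where
      distribute : ∀ x a₀ a₁ b₀ b₁ → x * (a₀ * b₀ + a₁ * b₁) ≈ x * a₀ * b₀ + x * a₁ * b₁
      distribute =
        solve 5 (λ x a₀ a₁ b₀ b₁ → x :* (a₀ :* b₀ :+ a₁ :* b₁) := x :* a₀ :* b₀ :+ x :* a₁ :* b₁) refl

    scalar-multiple : ∀ {g g′ : Matrix F 2} μ → det₂ g ≈ 1# → det₂ g′ ≈ 1# →
      (∀ i j → g i j ≈ g′ i j * μ) → g ≈ₘ g′
    scalar-multiple {g} {g′} μ det-g det-g′ g≈g′μ i j =
      trans (g≈g′μ i j) (trans (*-congˡ (square-injective μ²≈1)) (*-identityʳ _))
      where
      μ²≈1 : μ * μ ≈ 1# * 1#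
      μ²≈1 = begin
        μ * μ                ≈⟨ *-identityʳ _ ⟨
        μ * μ * 1#           ≈⟨ *-congˡ det-g′ ⟨
        μ * μ * det₂ g′      ≈⟨ solve 5 (λ m a b c d → m :* m :* (a :* d :+ b :* c)
                                  := a :* m :* (d :* m) :+ b :* m :* (c :* m))
                                refl μ (g′ 0F 0F) (g′ 0F 1F) (g′ 1F 0F) (g′ 1F 1F) ⟩
        (g′ 0F 0F * μ) * (g′ 1F 1F * μ) + (g′ 0F 1F * μ) * (g′ 1F 0F * μ)
                             ≈⟨ +-cong (*-cong (g≈g′μ 0F 0F) (g≈g′μ 1F 1F)) (*-cong (g≈g′μ 0F 1F) (g≈g′μ 1F 0F)) ⟨
        det₂ g               ≈⟨ det-g ⟩
        1#                   ≈⟨ 1·1≈1 ⟨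
        1# * 1#              ∎

  ⊗-injective : ∀ {g h g′ h′} → det₂ g ≈ 1# → det₂ h ≈ 1# → det₂ g′ ≈ 1# → det₂ h′ ≈ 1# →
    g ⊗ h ≈ₘ g′ ⊗ h′ → g ≈ₘ g′ × h ≈ₘ h′
  ⊗-injective {g} {h} {g′} {h′} det-g det-h det-g′ det-h′ e =
    scalar-multiple _ det-g det-g′ g≈g′μ , scalar-multiple _ det-h det-h′ h≈h′ν
    where
    e′ : ∀ p q → h (π₂ p) (π₂ q) * g (π₁ p) (π₁ q) ≈ h′ (π₂ p) (π₂ q) * g′ (π₁ p) (π₁ q)
    e′ p q = trans (*-comm _ _) (trans (e p q) (*-comm _ _))
    g≈g′μ : ∀ i j → g i j ≈ g′ i j * (h′ 0F 0F * h 1F 1F + h′ 0F 1F * h 1F 0F)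
    g≈g′μ 0F 0F = factor-scalar det-h (e 0F 0F) (e 0F 1F)
    g≈g′μ 0F 1F = factor-scalar det-h (e 0F 3F) (e 0F 2F)
    g≈g′μ 1F 0F = factor-scalar det-h (e 3F 0F) (e 3F 1F)
    g≈g′μ 1F 1F = factor-scalar det-h (e 3F 3F) (e 3F 2F)
    h≈h′ν : ∀ i j → h i j ≈ h′ i j * (g′ 0F 0F * g 1F 1F + g′ 0F 1F * g 1F 0F)
    h≈h′ν 0F 0F = factor-scalar det-g (e′ 0F 0F) (e′ 0F 3F)
    h≈h′ν 0F 1F = factor-scalar det-g (e′ 0F 1F) (e′ 0F 2F)
    h≈h′ν 1F 0F = factor-scalar det-g (e′ 1F 0F) (e′ 1F 3F)
    h≈h′ν 1F 1F = factor-scalar det-g (e′ 1F 1F) (e′ 1F 2F)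

  J : Fin 4 → Fin 4
  J 0F = 2F
  J 1F = 3F
  J 2F = 0F
  J 3F = 1F

  J-involutive : ∀ p → J (J p) ≡ p
  J-involutive 0F = ≡.refl
  J-involutive 1F = ≡.refl
  J-involutive 2F = ≡.refl
  J-involutive 3F = ≡.refl

  private
    open HyperbolicForm F using (B⁺; unit; column; row; θ⁺-column; B⁺-column)

    identity-J : ∀ p q → I p q ≈ I (J p) (J q)
    identity-J p q with p Fin.≟ q | J p Fin.≟ J q
    ... | yes _   | yes _     = refl
    ... | no _    | no _      = refl
    ... | yes p≡q | no Jp≢Jq  = ⊥-elim (Jp≢Jq (≡.cong J p≡q))
    ... | no p≢q  | yes Jp≡Jq = ⊥-elim (p≢q (≡.trans (≡.sym (J-involutive p))
                                              (≡.trans (≡.cong J Jp≡Jq) (J-involutive q))))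

    B⁺-unitˡ : ∀ p (y : Fin 4 → Carrier) → B⁺ 2 (unit p) y ≈ y (J p)
    B⁺-unitˡ 0F y = solve 4 (λ y₀ y₁ y₂ y₃ →
      con true :* y₂ :+ con false :* y₀ :+ (con false :* y₃ :+ con false :* y₁ :+ con false) := y₂)
      refl (y 0F) (y 1F) (y 2F) (y 3F)
    B⁺-unitˡ 1F y = solve 4 (λ y₀ y₁ y₂ y₃ →
      con false :* y₂ :+ con false :* y₀ :+ (con true :* y₃ :+ con false :* y₁ :+ con false) := y₃)
      refl (y 0F) (y 1F) (y 2F) (y 3F)
    B⁺-unitˡ 2F y = solve 4 (λ y₀ y₁ y₂ y₃ →
      con false :* y₂ :+ con true :* y₀ :+ (con false :* y₃ :+ con false :* y₁ :+ con false) := y₀)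
      refl (y 0F) (y 1F) (y 2F) (y 3F)
    B⁺-unitˡ 3F y = solve 4 (λ y₀ y₁ y₂ y₃ →
      con false :* y₂ :+ con false :* y₀ :+ (con false :* y₃ :+ con true :* y₁ :+ con false) := y₁)
      refl (y 0F) (y 1F) (y 2F) (y 3F)

    B⁺-units : ∀ p q → B⁺ 2 (unit p) (unit q) ≈ I p (J q)
    B⁺-units p q = trans (B⁺-unitˡ p (unit q))
      (trans (identity-J (J p) q) (reflexive (≡.cong (λ k → I k (J q)) (J-involutive p))))

    ∑-Jˡ : ∀ (x y : Fin 4 → Carrier) → ∑ 4 (λ k → x (J k) * y k) ≈ B⁺ 2 x y
    ∑-Jˡ x y = solve 8 (λ x₀ x₁ x₂ x₃ y₀ y₁ y₂ y₃ →
      x₂ :* y₀ :+ (x₃ :* y₁ :+ (x₀ :* y₂ :+ (x₁ :* y₃ :+ con false)))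
      := x₀ :* y₂ :+ x₂ :* y₀ :+ (x₁ :* y₃ :+ x₃ :* y₁ :+ con false))
      refl (x 0F) (x 1F) (x 2F) (x 3F) (y 0F) (y 1F) (y 2F) (y 3F)

    ∑-Jʳ : ∀ (x y : Fin 4 → Carrier) → ∑ 4 (λ k → x k * y (J k)) ≈ B⁺ 2 x y
    ∑-Jʳ x y = solve 8 (λ x₀ x₁ x₂ x₃ y₀ y₁ y₂ y₃ →
      x₀ :* y₂ :+ (x₁ :* y₃ :+ (x₂ :* y₀ :+ (x₃ :* y₁ :+ con false)))
      := x₀ :* y₂ :+ x₂ :* y₀ :+ (x₁ :* y₃ :+ x₃ :* y₁ :+ con false))
      refl (x 0F) (x 1F) (x 2F) (x 3F) (y 0F) (y 1F) (y 2F) (y 3F)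

  -- The rows of an orthogonal w satisfy the same relations as its columns, because its
  -- inverse is the adjoint J wᵀ J for the polar form.
  B⁺-rows : ∀ {w} → InO⁺ F 2 w → ∀ p q → B⁺ 2 (row w p) (row w q) ≈ B⁺ 2 (unit p) (unit q)
  B⁺-rows {w} (w-invertible , pres) p q = begin
    B⁺ 2 (row w p) (row w q)            ≈⟨ reflexive (≡.cong (λ k → B⁺ 2 (row w p) (row w k)) (J-involutive q)) ⟨
    B⁺ 2 (row w p) (row w (J (J q)))    ≈⟨ ∑-Jʳ (row w p) (row w (J (J q))) ⟨
    (w ·ₘ adjoint) p (J q)             ≈⟨ left-inverse⇒right-inverse {g = w} {h = adjoint}
                                            w-invertible adjoint-· p (J q) ⟩
    I p (J q)                          ≈⟨ B⁺-units p q ⟨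
    B⁺ 2 (unit p) (unit q)             ∎
    where
    adjoint : Matrix F 4
    adjoint p q = w (J q) (J p)
    adjoint-· : adjoint ·ₘ w ≈ₘ I
    adjoint-· p q = begin
      (adjoint ·ₘ w) p q                                ≈⟨ ∑-Jˡ (column w (J p)) (column w q) ⟩
      B⁺ 2 (column w (J p)) (column w q)                ≈⟨ B⁺-column 2 {w} pres (J p) q ⟩
      B⁺ 2 (unit (J p)) (unit q)                        ≈⟨ B⁺-units (J p) q ⟩
      I (J p) (J q)                                     ≈⟨ identity-J p q ⟨
      I p q                                             ∎

  private
    open 𝔽₂-Solver using (Polynomial; var; ⟦_⟧; ⟦_⟧↓; prove)

    polynomials : RawSemiring 0ℓ 0ℓ
    polynomials = record
      { Carrier = Polynomial 16 ; _≈_ = _≡_ ; _+_ = _:+_ ; _*_ = _:*_ ; 0# = con false ; 1# = con true }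

    module Symbolic = Forms₄ polynomials

    x : Fin 4 → Fin 4 → Polynomial 16
    x p q = var (Fin.combine p q)

    environment : Matrix F 4 → Vec Carrier 16
    environment w = Vec.tabulate (λ k → uncurry w (Fin.remQuot 4 k))

    ⟦x⟧ : ∀ w p q → ⟦ x p q ⟧ (environment w) ≡ w p q
    ⟦x⟧ w p q = ≡.trans (Vecₚ.lookup∘tabulate (λ k → uncurry w (Fin.remQuot 4 k)) (Fin.combine p q))
                         (≡.cong (uncurry w) (Finₚ.remQuot-combine p q))

    ⟦unit⟧ : ∀ ρ q k → ⟦ Symbolic.unit q k ⟧ ρ ≈ HyperbolicForm.unit F q k
    ⟦unit⟧ ρ q k with k Fin.≟ q
    ... | yes _ = refl
    ... | no _  = refl

  open Forms₄ (Semiring.rawSemiring semiring) using (minorᴳ; minorᴴ)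

  -- θ⁺ of a column, and B⁺ of two columns or of two rows, take the same values as on the unit
  -- vectors, and δ⁺ vanishes
  data Relation : Set where
    θ-column           : Fin 4 → Relation
    B-columns B-rows   : Fin 4 → Fin 4 → Relation
    δ-entries          : Relation

  private
    relation : Relation → Polynomial 16
    relation (θ-column q)    = Symbolic.θ (Symbolic.column x q) :+ Symbolic.θ (Symbolic.unit q)
    relation (B-columns p q) = Symbolic.B (Symbolic.column x p) (Symbolic.column x q)
                               :+ Symbolic.B (Symbolic.unit p) (Symbolic.unit q)
    relation (B-rows p q)    = Symbolic.B (Symbolic.row x p) (Symbolic.row x q)
                               :+ Symbolic.B (Symbolic.unit p) (Symbolic.unit q)
    relation δ-entries       = Symbolic.δ x

    infix 6 _⋆_
    _⋆_ : Polynomial 16 → Relation → Polynomial 16 × Relation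
    _⋆_ = _,_

    combination : List (Polynomial 16 × Relation) → Polynomial 16
    combination []             = con false
    combination ((m , r) ∷ cs) = m :* relation r :+ combination cs

  module Parametrization {w : Matrix F 4} (w∈SO⁺ : InSO⁺ F 2 w) where
    private
      ρ : Vec Carrier 16
      ρ = environment w
      open HyperbolicForm F using (θ⁺-cong; B⁺-cong)

      relation-vanishes : ∀ r → ⟦ relation r ⟧ ρ ≈ 0#
      relation-vanishes (θ-column q) = x≈y⇒x+y≈0 (begin
        θ⁺ F 2 (λ k → ⟦ x k q ⟧ ρ)             ≈⟨ θ⁺-cong 2 (λ k → reflexive (⟦x⟧ w k q)) ⟩
        θ⁺ F 2 (column w q)                    ≈⟨ θ⁺-column 2 {w} (proj₂ (proj₁ w∈SO⁺)) q ⟩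
        θ⁺ F 2 (unit q)                        ≈⟨ θ⁺-cong 2 (⟦unit⟧ ρ q) ⟨
        θ⁺ F 2 (λ k → ⟦ Symbolic.unit q k ⟧ ρ)  ∎)
      relation-vanishes (B-columns p q) = x≈y⇒x+y≈0 (begin
        B⁺ 2 (λ k → ⟦ x k p ⟧ ρ) (λ k → ⟦ x k q ⟧ ρ)  ≈⟨ B⁺-cong 2 (λ k → reflexive (⟦x⟧ w k p))
                                                                (λ k → reflexive (⟦x⟧ w k q)) ⟩
        B⁺ 2 (column w p) (column w q)              ≈⟨ B⁺-column 2 {w} (proj₂ (proj₁ w∈SO⁺)) p q ⟩
        B⁺ 2 (unit p) (unit q)                      ≈⟨ B⁺-cong 2 (⟦unit⟧ ρ p) (⟦unit⟧ ρ q) ⟨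
        B⁺ 2 (λ k → ⟦ Symbolic.unit p k ⟧ ρ) (λ k → ⟦ Symbolic.unit q k ⟧ ρ) ∎)
      relation-vanishes (B-rows p q) = x≈y⇒x+y≈0 (begin
        B⁺ 2 (λ k → ⟦ x p k ⟧ ρ) (λ k → ⟦ x q k ⟧ ρ)  ≈⟨ B⁺-cong 2 (λ k → reflexive (⟦x⟧ w p k))
                                                                (λ k → reflexive (⟦x⟧ w q k)) ⟩
        B⁺ 2 (row w p) (row w q)                    ≈⟨ B⁺-rows {w} (proj₁ w∈SO⁺) p q ⟩
        B⁺ 2 (unit p) (unit q)                      ≈⟨ B⁺-cong 2 (⟦unit⟧ ρ p) (⟦unit⟧ ρ q) ⟨
        B⁺ 2 (λ k → ⟦ Symbolic.unit p k ⟧ ρ) (λ k → ⟦ Symbolic.unit q k ⟧ ρ) ∎)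
      relation-vanishes δ-entries = proj₂ w∈SO⁺

      combination-vanishes : ∀ cs → ⟦ combination cs ⟧ ρ ≈ 0#
      combination-vanishes []             = refl
      combination-vanishes ((m , r) ∷ cs) =
        trans (+-cong (trans (*-congˡ (relation-vanishes r)) (zeroʳ _)) (combination-vanishes cs)) (+-identityʳ 0#)

      -- e vanishes if it equals, as a polynomial, a combination of the relations; the
      -- certificates below are such combinations, checked by normalisation (refl).
      certified : ∀ e cs → ⟦ e ⟧↓ ρ ≈ ⟦ combination cs ⟧↓ ρ → ⟦ e ⟧ ρ ≈ 0#
      certified e cs normal-forms≈ = trans (prove ρ e (combination cs) normal-forms≈) (combination-vanishes cs)

      square : Fin 4 → Fin 4 → Polynomial 16
      square p q = x p q :* x p q :+ Symbolic.minorᴳ x (π₁ p) (π₁ q) :* Symbolic.minorᴴ x (π₂ p) (π₂ q)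

      determinantᴳ determinantᴴ : Polynomial 16
      determinantᴳ = G 0F 0F :* G 1F 1F :+ G 0F 1F :* G 1F 0F :+ con true
        where
        G : Fin 2 → Fin 2 → Polynomial 16
        G = Symbolic.minorᴳ x
      determinantᴴ = H 0F 0F :* H 1F 1F :+ H 0F 1F :* H 1F 0F :+ con true
        where
        H : Fin 2 → Fin 2 → Polynomial 16
        H = Symbolic.minorᴴ x

    entry² : ∀ p q → w p q * w p q + minorᴳ w (π₁ p) (π₁ q) * minorᴴ w (π₂ p) (π₂ q) ≈ 0#
    entry² 0F 0F = certified (square 0F 0F)
      ( x 0F 0F :* x 0F 2F ⋆ θ-column 0F ∷ x 0F 1F :* x 0F 3F ⋆ θ-column 0F
      ∷ x 0F 0F :* x 3F 0F ⋆ B-rows 0F 1F ∷ x 0F 0F :* x 0F 1F ⋆ B-columns 0F 3F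
      ∷ x 0F 0F :* x 0F 0F ⋆ B-columns 1F 3F ∷ x 0F 0F :* x 0F 0F ⋆ δ-entries ∷ []) refl
    entry² 0F 1F = certified (square 0F 1F)
      ( x 0F 0F :* x 0F 2F ⋆ θ-column 1F ∷ x 0F 1F :* x 0F 3F ⋆ θ-column 1F
      ∷ x 0F 1F :* x 3F 1F ⋆ B-rows 0F 1F ∷ x 0F 1F :* x 0F 1F ⋆ B-columns 0F 2F
      ∷ x 0F 0F :* x 0F 1F ⋆ B-columns 1F 2F ∷ x 0F 1F :* x 0F 1F ⋆ δ-entries ∷ []) refl
    entry² 0F 2F = certified (square 0F 2F)
      ( x 0F 0F :* x 0F 2F ⋆ θ-column 2F ∷ x 0F 1F :* x 0F 3F ⋆ θ-column 2F
      ∷ x 0F 2F :* x 3F 2F ⋆ B-rows 0F 1F ∷ x 0F 2F :* x 0F 2F ⋆ B-columns 0F 2F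
      ∷ x 0F 2F :* x 0F 3F ⋆ B-columns 1F 2F ∷ x 0F 2F :* x 0F 2F ⋆ δ-entries ∷ []) refl
    entry² 0F 3F = certified (square 0F 3F)
      ( x 0F 0F :* x 0F 2F ⋆ θ-column 3F ∷ x 0F 1F :* x 0F 3F ⋆ θ-column 3F
      ∷ x 0F 3F :* x 3F 3F ⋆ B-rows 0F 1F ∷ x 0F 2F :* x 0F 3F ⋆ B-columns 0F 3F
      ∷ x 0F 3F :* x 0F 3F ⋆ B-columns 1F 3F ∷ x 0F 3F :* x 0F 3F ⋆ δ-entries ∷ []) refl
    entry² 1F 0F = certified (square 1F 0F)
      ( x 1F 0F :* x 1F 2F ⋆ θ-column 0F ∷ x 1F 1F :* x 1F 3F ⋆ θ-column 0F
      ∷ x 1F 0F :* x 1F 3F ⋆ B-columns 0F 1F ∷ x 1F 0F :* x 1F 0F ⋆ B-rows 0F 2F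
      ∷ x 0F 0F :* x 1F 0F ⋆ B-rows 1F 2F ∷ x 1F 0F :* x 1F 0F ⋆ δ-entries ∷ []) refl
    entry² 1F 1F = certified (square 1F 1F)
      ( x 1F 0F :* x 1F 2F ⋆ θ-column 1F ∷ x 1F 1F :* x 1F 3F ⋆ θ-column 1F
      ∷ x 1F 1F :* x 2F 1F ⋆ B-rows 0F 1F ∷ x 1F 1F :* x 1F 1F ⋆ B-columns 0F 2F
      ∷ x 1F 0F :* x 1F 1F ⋆ B-columns 1F 2F ∷ x 1F 1F :* x 1F 1F ⋆ δ-entries ∷ []) refl
    entry² 1F 2F = certified (square 1F 2F)
      ( x 1F 0F :* x 1F 2F ⋆ θ-column 2F ∷ x 1F 1F :* x 1F 3F ⋆ θ-column 2F
      ∷ x 1F 2F :* x 2F 2F ⋆ B-rows 0F 1F ∷ x 1F 2F :* x 1F 2F ⋆ B-columns 0F 2F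
      ∷ x 1F 2F :* x 1F 3F ⋆ B-columns 1F 2F ∷ x 1F 2F :* x 1F 2F ⋆ δ-entries ∷ []) refl
    entry² 1F 3F = certified (square 1F 3F)
      ( x 1F 0F :* x 1F 2F ⋆ θ-column 3F ∷ x 1F 1F :* x 1F 3F ⋆ θ-column 3F
      ∷ x 1F 3F :* x 2F 3F ⋆ B-rows 0F 1F ∷ x 1F 2F :* x 1F 3F ⋆ B-columns 0F 3F
      ∷ x 1F 3F :* x 1F 3F ⋆ B-columns 1F 3F ∷ x 1F 3F :* x 1F 3F ⋆ δ-entries ∷ []) refl
    entry² 2F 0F = certified (square 2F 0F)
      ( x 2F 0F :* x 2F 2F ⋆ θ-column 0F ∷ x 2F 1F :* x 2F 3F ⋆ θ-column 0F
      ∷ x 2F 0F :* x 2F 3F ⋆ B-columns 0F 1F ∷ x 2F 0F :* x 2F 0F ⋆ B-rows 0F 2F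
      ∷ x 2F 0F :* x 3F 0F ⋆ B-rows 1F 2F ∷ x 2F 0F :* x 2F 0F ⋆ δ-entries ∷ []) refl
    entry² 2F 1F = certified (square 2F 1F)
      ( x 2F 0F :* x 2F 2F ⋆ θ-column 1F ∷ x 2F 1F :* x 2F 3F ⋆ θ-column 1F
      ∷ x 2F 1F :* x 2F 2F ⋆ B-columns 0F 1F ∷ x 2F 1F :* x 2F 1F ⋆ B-rows 0F 2F
      ∷ x 2F 1F :* x 3F 1F ⋆ B-rows 1F 2F ∷ x 2F 1F :* x 2F 1F ⋆ δ-entries ∷ []) refl
    entry² 2F 2F = certified (square 2F 2F)
      ( x 2F 0F :* x 2F 2F ⋆ θ-column 2F ∷ x 2F 1F :* x 2F 3F ⋆ θ-column 2F
      ∷ x 2F 2F :* x 2F 2F ⋆ B-columns 0F 2F ∷ x 2F 2F :* x 2F 2F ⋆ B-rows 0F 2F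
      ∷ x 2F 2F :* x 3F 2F ⋆ B-rows 1F 2F ∷ x 2F 2F :* x 2F 2F ⋆ B-columns 1F 3F
      ∷ x 2F 1F :* x 2F 2F ⋆ B-columns 2F 3F ∷ x 2F 2F :* x 2F 2F ⋆ δ-entries ∷ []) refl
    entry² 2F 3F = certified (square 2F 3F)
      ( x 2F 0F :* x 2F 2F ⋆ θ-column 3F ∷ x 2F 1F :* x 2F 3F ⋆ θ-column 3F
      ∷ x 2F 3F :* x 2F 3F ⋆ B-columns 0F 2F ∷ x 2F 3F :* x 2F 3F ⋆ B-rows 0F 2F
      ∷ x 2F 3F :* x 3F 3F ⋆ B-rows 1F 2F ∷ x 2F 3F :* x 2F 3F ⋆ B-columns 1F 3F
      ∷ x 2F 0F :* x 2F 3F ⋆ B-columns 2F 3F ∷ x 2F 3F :* x 2F 3F ⋆ δ-entries ∷ []) refl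
    entry² 3F 0F = certified (square 3F 0F)
      ( x 3F 0F :* x 3F 2F ⋆ θ-column 0F ∷ x 3F 1F :* x 3F 3F ⋆ θ-column 0F
      ∷ x 3F 0F :* x 3F 3F ⋆ B-columns 0F 1F ∷ x 3F 0F :* x 3F 0F ⋆ B-columns 0F 2F
      ∷ x 3F 0F :* x 3F 0F ⋆ B-rows 0F 2F ∷ x 2F 0F :* x 3F 0F ⋆ B-rows 0F 3F
      ∷ x 3F 0F :* x 3F 0F ⋆ B-columns 1F 3F ∷ x 3F 0F :* x 3F 0F ⋆ δ-entries ∷ []) refl
    entry² 3F 1F = certified (square 3F 1F)
      ( x 3F 0F :* x 3F 2F ⋆ θ-column 1F ∷ x 3F 1F :* x 3F 3F ⋆ θ-column 1F
      ∷ x 3F 1F :* x 3F 2F ⋆ B-columns 0F 1F ∷ x 3F 1F :* x 3F 1F ⋆ B-columns 0F 2F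
      ∷ x 3F 1F :* x 3F 1F ⋆ B-rows 0F 2F ∷ x 2F 1F :* x 3F 1F ⋆ B-rows 0F 3F
      ∷ x 3F 1F :* x 3F 1F ⋆ B-columns 1F 3F ∷ x 3F 1F :* x 3F 1F ⋆ δ-entries ∷ []) refl
    entry² 3F 2F = certified (square 3F 2F)
      ( x 3F 0F :* x 3F 2F ⋆ θ-column 2F ∷ x 3F 1F :* x 3F 3F ⋆ θ-column 2F
      ∷ x 3F 2F :* x 3F 2F ⋆ B-rows 0F 2F ∷ x 2F 2F :* x 3F 2F ⋆ B-rows 0F 3F
      ∷ x 3F 1F :* x 3F 2F ⋆ B-columns 2F 3F ∷ x 3F 2F :* x 3F 2F ⋆ δ-entries ∷ []) refl
    entry² 3F 3F = certified (square 3F 3F)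
      ( x 3F 0F :* x 3F 2F ⋆ θ-column 3F ∷ x 3F 1F :* x 3F 3F ⋆ θ-column 3F
      ∷ x 3F 3F :* x 3F 3F ⋆ B-rows 0F 2F ∷ x 2F 3F :* x 3F 3F ⋆ B-rows 0F 3F
      ∷ x 3F 0F :* x 3F 3F ⋆ B-columns 2F 3F ∷ x 3F 3F :* x 3F 3F ⋆ δ-entries ∷ []) refl

    det₂-minorᴳ : det₂ (minorᴳ w) + 1# ≈ 0#
    det₂-minorᴳ = certified determinantᴳ
      ( x 1F 3F :* x 3F 2F ⋆ B-columns 0F 1F ∷ x 2F 0F :* x 3F 2F ⋆ B-rows 0F 1F
      ∷ con true ⋆ B-columns 0F 2F ∷ x 0F 3F :* x 2F 1F ⋆ B-columns 0F 2F
      ∷ x 1F 3F :* x 3F 1F ⋆ B-columns 0F 2F ∷ x 1F 0F :* x 3F 2F ⋆ B-rows 0F 2F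
      ∷ x 0F 2F :* x 2F 1F ⋆ B-columns 0F 3F ∷ x 1F 1F :* x 3F 2F ⋆ B-columns 0F 3F
      ∷ x 1F 2F :* x 3F 1F ⋆ B-columns 0F 3F ∷ x 0F 0F :* x 2F 3F ⋆ B-columns 1F 2F
      ∷ x 1F 0F :* x 3F 3F ⋆ B-columns 1F 2F ∷ x 0F 0F :* x 3F 2F ⋆ B-rows 1F 2F
      ∷ x 0F 0F :* x 2F 2F ⋆ B-columns 1F 3F ∷ con true ⋆ δ-entries ∷ []) refl

    det₂-minorᴴ : det₂ (minorᴴ w) + 1# ≈ 0#
    det₂-minorᴴ = certified determinantᴴ
      ( x 0F 2F :* x 2F 3F ⋆ B-columns 0F 1F ∷ x 1F 2F :* x 3F 3F ⋆ B-columns 0F 1F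
      ∷ x 2F 0F :* x 3F 2F ⋆ B-rows 0F 1F ∷ x 2F 2F :* x 3F 0F ⋆ B-rows 0F 1F
      ∷ con true ⋆ B-columns 0F 2F ∷ x 0F 0F :* x 2F 2F ⋆ B-columns 0F 2F
      ∷ x 0F 3F :* x 2F 1F ⋆ B-columns 0F 2F ∷ x 1F 1F :* x 3F 3F ⋆ B-columns 0F 2F
      ∷ con true ⋆ B-rows 0F 2F ∷ x 0F 0F :* x 2F 2F ⋆ B-rows 0F 2F
      ∷ x 1F 0F :* x 3F 2F ⋆ B-rows 0F 2F ∷ x 0F 1F :* x 2F 2F ⋆ B-columns 0F 3F
      ∷ x 0F 2F :* x 2F 1F ⋆ B-columns 0F 3F ∷ x 1F 2F :* x 2F 0F ⋆ B-rows 0F 3F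
      ∷ x 0F 3F :* x 2F 0F ⋆ B-columns 1F 2F ∷ x 1F 0F :* x 3F 3F ⋆ B-columns 1F 2F
      ∷ x 0F 2F :* x 3F 0F ⋆ B-rows 1F 2F ∷ con true ⋆ B-columns 1F 3F
      ∷ x 0F 2F :* x 2F 0F ⋆ B-columns 1F 3F ∷ con true ⋆ δ-entries ∷ []) refl

    factorᴳ factorᴴ : Matrix F 2
    factorᴳ i j = √ (minorᴳ w i j)
    factorᴴ i j = √ (minorᴴ w i j)

    private
      det₂-√ : ∀ (G : Matrix F 2) → det₂ G + 1# ≈ 0# → det₂ (λ i j → √ (G i j)) ≈ 1#
      det₂-√ G det+1≈0 = square-injective (begin
        det₂ (λ i j → √ (G i j)) * det₂ (λ i j → √ (G i j))
          ≈⟨ solve 4 (λ a b c d → (a :* d :+ b :* c) :* (a :* d :+ b :* c) := a :* a :* (d :* d) :+ b :* b :* (c :* c))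
               refl (√ (G 0F 0F)) (√ (G 0F 1F)) (√ (G 1F 0F)) (√ (G 1F 1F)) ⟩
        √ (G 0F 0F) * √ (G 0F 0F) * (√ (G 1F 1F) * √ (G 1F 1F))
          + √ (G 0F 1F) * √ (G 0F 1F) * (√ (G 1F 0F) * √ (G 1F 0F))
          ≈⟨ +-cong (*-cong (√-square _) (√-square _)) (*-cong (√-square _) (√-square _)) ⟩
        det₂ G                   ≈⟨ x+y≈0⇒x≈y det+1≈0 ⟩
        1#                       ≈⟨ 1·1≈1 ⟨
        1# * 1#                  ∎)

    det₂-factorᴳ : det₂ factorᴳ ≈ 1#
    det₂-factorᴳ = det₂-√ (minorᴳ w) det₂-minorᴳ

    det₂-factorᴴ : det₂ factorᴴ ≈ 1#
    det₂-factorᴴ = det₂-√ (minorᴴ w) det₂-minorᴴ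

    ≈-factorᴳ⊗factorᴴ : w ≈ₘ factorᴳ ⊗ factorᴴ
    ≈-factorᴳ⊗factorᴴ p q = square-injective (begin
      w p q * w p q          ≈⟨ x+y≈0⇒x≈y (entry² p q) ⟩
      G * H                  ≈⟨ *-cong (√-square G) (√-square H) ⟨
      √ G * √ G * (√ H * √ H) ≈⟨ solve 2 (λ a b → a :* a :* (b :* b) := a :* b :* (a :* b)) refl (√ G) (√ H) ⟩
      √ G * √ H * (√ G * √ H) ∎)
      where
      G H : Carrier
      G = minorᴳ w (π₁ p) (π₁ q)
      H = minorᴴ w (π₂ p) (π₂ q)

module TraceSum₄ (F : FiniteField) (χ : AdditiveCharacter F) (nontrivial : Nontrivial χ) where
  open FiniteField F
  open AdditiveCharacter χ
  open FieldSums F using (q)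
  open Characters F χ using (nontrivial⇒characteristic2)
  private
    char2 : HasCharacteristic2 F
    char2 = nontrivial⇒characteristic2 nontrivial
  open Matrices F using (Tr-cong)
  open SpecialLinear₂ F char2
  open TensorProduct F char2
  open TraceProductSum F χ nontrivial using (traceProductSum-SL₂)

  SO⁺₄ : List (Matrix F 4)
  SO⁺₄ = cartesianProductWith _⊗_ SL₂ SL₂

  Enumerates-SO⁺₄ : Enumerates (MatrixSetoid F 4) (InSO⁺ F 2) SO⁺₄
  Enumerates-SO⁺₄ = record
    { sound    = AllP.cartesianProductWith⁺ (MatrixSetoid F 2) (MatrixSetoid F 2) _⊗_ SL₂ SL₂
                   (λ {g} {h} g∈ h∈ → ⊗-∈SO⁺ g h (∈-SL₂⇒det₂≈1 g∈) (∈-SL₂⇒det₂≈1 h∈))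
    ; complete = complete
    ; unique   = UniqueImages.Unique-cartesianProductWith-on (MatrixSetoid F 2) (MatrixSetoid F 2) (MatrixSetoid F 4)
                   _⊗_ (λ {g} {g′} {h} {h′} g∈ g′∈ h∈ h′∈ → ⊗-injective {g} {h} {g′} {h′}
                                                    (∈-SL₂⇒det₂≈1 g∈) (∈-SL₂⇒det₂≈1 h∈)
                                                    (∈-SL₂⇒det₂≈1 g′∈) (∈-SL₂⇒det₂≈1 h′∈))
                   Unique-SL₂ Unique-SL₂
    }
    where
    complete : ∀ w → InSO⁺ F 2 w → Membership._∈_ (MatrixSetoid F 4) w SO⁺₄
    complete w w∈SO⁺ = Membershipₚ.∈-resp-≈ (MatrixSetoid F 4) (λ p q → sym (≈-factorᴳ⊗factorᴴ p q))
      (Membershipₚ.∈-cartesianProductWith⁺ (MatrixSetoid F 2) (MatrixSetoid F 2) (MatrixSetoid F 4) ⊗-cong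
        {a = factorᴳ} {b = factorᴴ} (∈-SL₂ {factorᴳ} det₂-factorᴳ) (∈-SL₂ {factorᴴ} det₂-factorᴴ))
      where open Parametrization {w} w∈SO⁺

  traceSum-SO⁺₄ : ∀ {L} → Enumerates (MatrixSetoid F 4) (InSO⁺ F 2) L →
    traceSum F χ L ≡ (q *ℤ q) *ℤ (Kloosterman F χ 1# *ℤ Kloosterman F χ 1# +ℤ q *ℤ q *ℤ q -ℤ q)
  traceSum-SO⁺₄ {L} enum-L = begin
    traceSum F χ L                                         ≡⟨ UniqueLists.sumMap-Enumerates (MatrixSetoid F 4)
                                                               (λ w → ψ (Tr F w)) (λ w≈w′ → ψ-cong (Tr-cong w≈w′))
                                                               enum-L Enumerates-SO⁺₄ ⟩
    traceSum F χ SO⁺₄                                      ≡⟨ sumMap-cartesianProductWith _ _⊗_ SL₂ SL₂ ⟩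
    sumMap (λ g → sumMap (λ h → ψ (Tr F (g ⊗ h))) SL₂) SL₂ ≡⟨ sumMap-cong (λ g → sumMap-cong (λ h →
                                                               ψ-cong (Tr-⊗ g h)) SL₂) SL₂ ⟩
    sumMap (λ g → sumMap (λ h → ψ (tr₂ g * tr₂ h)) SL₂) SL₂  ≡⟨ traceProductSum-SL₂ ⟩
    (q *ℤ q) *ℤ (Kloosterman F χ 1# *ℤ Kloosterman F χ 1# +ℤ q *ℤ q *ℤ q -ℤ q) ∎
    where open ≡.≡-Reasoning

open import Data.Integer using (_+_; _-_; _*_)

theorem3 : (r : ℕ) (F : FiniteField) → order F ≡ 2 ^ r →
    (χ : AdditiveCharacter F) → Nontrivial χ →
    let open FiniteField F using (1#) in
    let q = + (order F) in
    let K = Kloosterman F χ 1# in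
    ((L : List (Matrix F 2)) → Enumerates (MatrixSetoid F 2) (InSO⁺ F 1) L →
      traceSum F χ L ≡ K)
    × ((L : List (Matrix F 2)) → Enumerates (MatrixSetoid F 2) (InO⁺ F 1) L →
      traceSum F χ L ≡ K + q - + 1)
    × ((L : List (Matrix F 4)) → Enumerates (MatrixSetoid F 4) (InSO⁺ F 2) L →
      traceSum F χ L ≡ (q * q) * (K * K + q * q * q - q))
theorem3 _ F _ χ nontrivial =
    (λ _ → TraceSums₂.traceSum-SO⁺₂ F χ)
  , (λ _ → TraceSums₂.traceSum-O⁺₂ F χ)
  , (λ _ → TraceSum₄.traceSum-SO⁺₄ F χ nontrivial)
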